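{- Let $G$ be a nontrivial finite group with the supercharacter theory whose superclasses are $\{1\}$ and $G\setminus\{1\}$, so $\mathrm{scf}(G)=\mathbb{C}\text{ -span}\{\mathbb{1},\mathbf{reg}\}$, let $(\iota,\alpha,\beta)$ be a Hopf triple and $S$ the antipode of $\mathcal{H}_{(\iota,\alpha,\beta)}$. For $\tau\in\mathrm{scf}(G)$ and $n\ge1$ write $(\tau_\bullet)^\iota_{(n)}=\tau^{\otimes(n-1)}\in\mathrm{scf}(G^{n-1})$. (Case $\alpha=\beta$.) If $\tau\in\mathrm{scf}(G)$ is nonzero with $\langle\tau,\beta\rangle=0$ and $\mathbb{C}\text{ -span}\{\tau,\iota\}=\mathrm{scf}(G)$, then $S((\tau_\bullet)^\iota_{(n)})=-(\tau_\bullet)^\iota_{(n)}$. (Case $\alpha\ne\beta$.) If $\tau\in\mathrm{scf}(G)$ satisfies $\langle\tau,\alpha\rangle=1$ and $\langle\tau,\beta\rangle=0$, then $S((\tau_\bullet)^\iota_{(n)})=-((\tau-\iota)_\bullet)^\iota_{(n)}$.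
   Context: $\langle\psi,\gamma\rangle=\frac1{|G|}\sum_g\psi(g)\overline{\gamma(g)}$; $\mathbb{1}$ trivial, $\mathbf{reg}$ regular character. For $n\ge1$, $\mathrm{scf}(G^{n-1}):=\mathrm{scf}(G)^{\otimes(n-1)}$ as functions on $G^{n-1}=G\times\cdots\times G\times\{1\}$ via $(g_i)\mapsto\prod\psi_i(g_i)$ (for $n=1$: $\mathbb{C}\chi^{()}$); $\mathrm{scf}(G^{0-1})=\mathbb{C}\chi^\emptyset$. Hopf triple: $\langle\iota,\alpha\rangle=\langle\iota,\beta\rangle=1$. $\mathcal{H}_{(\iota,\alpha,\beta)}=\bigoplus_{n\ge0}\mathrm{scf}(G^{n-1})$ (degree $n$), unit $\chi^\emptyset$, product $(\psi_1\otimes\cdots\otimes\psi_{m-1})\cdot(\gamma_1\otimes\cdots\otimes\gamma_{n-1})=\psi_1\otimes\cdots\otimes\psi_{m-1}\otimes\iota\otimes\gamma_1\otimes\cdots\otimes\gamma_{n-1}$, counit projection to degree 0, coproduct $\Delta(\chi^\emptyset)=\chi^\emptyset\otimes\chi^\emptyset$, $\Delta(\psi)=\chi^\emptyset\otimes\psi+\psi\otimes\chi^\emptyset+\sum_{\emptyset\ne A\subsetneq\{1..n\}}D_A(\psi)$ where, $B$ the complement: $\varphi_j=\psi_j$ if $j,j+1$ in the same one of $A,B$, $\varphi_j=\langle\psi_j,\alpha\rangle\iota$ if $j\in A,j+1\in B$, $\varphi_j=\langle\psi_j,\beta\rangle\iota$ if $j\in B,j+1\in A$; $c_A=\prod_{j\in\{\max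 A,\max B\},j\ne n}(\langle\psi_j,\alpha\rangle$ if $j\in A$, $\langle\psi_j,\beta\rangle$ if $j\in B)$; $D_A(\psi)=c_A(\bigotimes_{j\in A\setminus\{\max A\}}\varphi_j)\otimes(\bigotimes_{j\in B\setminus\{\max B\}}\varphi_j)$, increasing $j$; it is a Hopf algebra. -}

module Defs where

open import Level using (Level; _⊔_) renaming (suc to lsuc)
open import Algebra.Bundles using (CommutativeRing; Group)
open import Data.Bool using (Bool; true; false; if_then_else_; not)
open import Data.Bool.Properties using () renaming (_≟_ to _≟B_)
open import Data.Nat using (ℕ; zero; suc; _∸_)
open import Data.Fin using (Fin)
open import Data.Fin.Properties using () renaming (_≟_ to _≟F_)
open import Data.List using (List; []; _∷_; _++_; map; concatMap; foldr)
import Data.List.Properties as LP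
open import Data.Maybe using (Maybe; nothing; just)
import Data.Maybe.Properties as MP
open import Data.Product using (_×_; _,_; ∃; ∃-syntax)
open import Function.Bundles using (Inverse)
open import Relation.Nullary using (¬_; Dec; yes; no; does)
open import Relation.Binary.PropositionalEquality as ≡ using (_≡_)

-- Scalar field: an abstract field of characteristic 0 with a
-- conjugation (involutive ring automorphism); ℂ is the intended model.

natR : ∀ {c ℓ} (R : CommutativeRing c ℓ) → ℕ → CommutativeRing.Carrier R
natR R zero    = CommutativeRing.0# R
natR R (suc n) = CommutativeRing._+_ R (CommutativeRing.1# R) (natR R n)

record StarField (c ℓ : Level) : Set (lsuc (c ⊔ ℓ)) where
  field
    commutativeRing : CommutativeRing c ℓ
  open CommutativeRing commutativeRing public
  field
    0≉1       : ¬ (0# ≈ 1#)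
    _⁻¹       : Carrier → Carrier
    ⁻¹-inverse : ∀ x → ¬ (x ≈ 0#) → x * (x ⁻¹) ≈ 1#
    char0     : ∀ n → ¬ (natR commutativeRing (suc n) ≈ 0#)
    conj      : Carrier → Carrier
    conj-cong : ∀ {x y} → x ≈ y → conj x ≈ conj y
    conj-+    : ∀ x y → conj (x + y) ≈ conj x + conj y
    conj-*    : ∀ x y → conj (x * y) ≈ conj x * conj y
    conj-1    : conj 1# ≈ 1#
    conj-invol : ∀ x → conj (conj x) ≈ x

record FiniteGroup (g ℓ : Level) : Set (lsuc (g ⊔ ℓ)) where
  field
    group : Group g ℓ
  open Group group public
  field
    order : ℕ
    enum  : Inverse setoid (≡.setoid (Fin order))
  open Inverse enum public using (to; from)
  isOne : Carrier → Bool
  isOne x = does (to x ≟F to ε)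

module Setup {c ℓ g ℓg : Level} (K : StarField c ℓ) (G : FiniteGroup g ℓg) where
  open StarField K
  natK = natR commutativeRing
  open FiniteGroup G using (order; from; isOne)

  -- A superclass function on G (supercharacter theory {1}, G∖{1}) is
  -- given by its value on the superclass {1} (true) and on G∖{1} (false).
  SCF : Set c
  SCF = Bool → Carrier

  ⟦_⟧ : SCF → FiniteGroup.Carrier G → Carrier
  ⟦ ψ ⟧ x = ψ (isOne x)

  sumFin : ∀ {n} → (Fin n → Carrier) → Carrier
  sumFin {zero}  f = 0#
  sumFin {suc n} f = f Fin.zero + sumFin (λ i → f (Fin.suc i))

  ⟨_,_⟩ : SCF → SCF → Carrier
  ⟨ ψ , γ ⟩ = (natK order ⁻¹) * sumFin (λ i → ⟦ ψ ⟧ (from i) * conj (⟦ γ ⟧ (from i)))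

  𝟙 : SCF
  𝟙 _ = 1#

  reg : SCF
  reg true  = natK order
  reg false = 0#

  δ : Bool → SCF
  δ b b' = if does (b ≟B b') then 1# else 0#

  -- The graded vector space H = ⊕_n scf(G^{n-1}), with basis words:
  --   nothing  ↦ χ^∅ (degree 0)
  --   just w   ↦ δ_{w_1} ⊗ ⋯ ⊗ δ_{w_{n-1}} ∈ scf(G^{n-1}), n = length w + 1
  -- (for w = [] this is χ^() in degree 1).
  Word : Set
  Word = Maybe (List Bool)

  Lin : Set c
  Lin = List (Carrier × Word)

  _≟W_ : (u v : Word) → Dec (u ≡ v)
  _≟W_ = MP.≡-dec (LP.≡-dec _≟B_)

  coeff : Lin → Word → Carrier
  coeff []            w = 0#
  coeff ((k , u) ∷ l) w = (if does (u ≟W w) then k else 0#) + coeff l w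

  infix 4 _≈L_
  _≈L_ : Lin → Lin → Set ℓ
  l ≈L l' = ∀ w → coeff l w ≈ coeff l' w

  scale : Carrier → Lin → Lin
  scale k = map (λ { (a , w) → (k * a , w) })

  negL : Lin → Lin
  negL = scale (- 1#)

  allWords : ℕ → List (List Bool)
  allWords zero    = [] ∷ []
  allWords (suc n) = map (true ∷_) (allWords n) ++ map (false ∷_) (allWords n)

  prodK : List Carrier → Carrier
  prodK = foldr _*_ 1#

  -- tensor power τ^{⊗(n-1)} ∈ scf(G^{n-1}) (for n ≥ 1), i.e. (τ_•)^ι_(n)
  tensorPow : SCF → ℕ → Lin
  tensorPow τ n = map (λ w → (prodK (map τ w) , just w)) (allWords (n ∸ 1))

  -- expansion of a tensor product of elements of scf(G) in the basis
  expand : List SCF → List (Carrier × List Bool)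
  expand []       = (1# , []) ∷ []
  expand (f ∷ fs) = concatMap (λ { (k , u) → (f true * k , true ∷ u) ∷ (f false * k , false ∷ u) ∷ [] }) (expand fs)

  module Hopf (ι α β : SCF) where

    mulB : Word → Word → Lin
    mulB nothing  y        = (1# , y) ∷ []
    mulB (just u) nothing  = (1# , just u) ∷ []
    mulB (just u) (just v) = (ι true , just (u ++ true ∷ v)) ∷ (ι false , just (u ++ false ∷ v)) ∷ []

    mulL : Lin → Lin → Lin
    mulL l l' = concatMap (λ { (a , x) → concatMap (λ { (b , y) → scale (a * b) (mulB x y) }) l' }) l

    ε : Word → Carrier
    ε nothing  = 1#
    ε (just _) = 0#

    eqB : Bool → Bool → Bool
    eqB a b = does (a ≟B b)

    occurs : Bool → List Bool → Bool
    occurs a []       = false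
    occurs a (b ∷ bs) = if eqB a b then true else occurs a bs

    -- For a basis word w = (w_1 … w_{n-1}) and a mask (A_1 … A_n)
    -- (A_j = true iff j ∈ A), compute (c_A , left factors , right factors)
    -- of D_A, where φ_j is as in the definition.  Index j is the maximum of
    -- its own block iff its mask value does not occur later; since
    -- j ≤ n-1 here, such j contribute to c_A (j ≠ n) and are omitted.
    dTerm : List Bool → List Bool → Carrier × List SCF × List SCF
    dTerm (x ∷ w) (a ∷ b ∷ m) with dTerm w (b ∷ m)
    ... | (c , L , R) =
      if not (occurs a (b ∷ m))
        then ((if a then ⟨ δ x , α ⟩ else ⟨ δ x , β ⟩) * c , L , R)
        else (if a then (c , φ ∷ L , R) else (c , L , φ ∷ R))
      where
      φ : SCF
      φ = if eqB a b then δ x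
          else (if a then (λ t → ⟨ δ x , α ⟩ * ι t) else (λ t → ⟨ δ x , β ⟩ * ι t))
    dTerm _ _ = (1# , [] , [])

    D : List Bool → List Bool → List (Carrier × Word × Word)
    D w mask with dTerm w mask
    ... | (c , L , R) =
      concatMap (λ { (k , u) → map (λ { (k' , v) → (c * k * k' , just u , just v) }) (expand R) }) (expand L)

    allTrue : List Bool → Bool
    allTrue []       = true
    allTrue (b ∷ bs) = if b then allTrue bs else false

    allFalse : List Bool → Bool
    allFalse []       = true
    allFalse (b ∷ bs) = if b then false else allFalse bs

    properMasks : ℕ → List (List Bool)
    properMasks n = concatMap (λ m → if allTrue m then [] else (if allFalse m then [] else m ∷ [])) (allWords n)

    Δ : Word → List (Carrier × Word × Word)
    Δ nothing  = (1# , nothing , nothing) ∷ []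
    Δ (just w) = (1# , nothing , just w) ∷ (1# , just w , nothing)
                 ∷ concatMap (D w) (properMasks (suc (Data.List.length w)))

    ext : (Word → Lin) → Lin → Lin
    ext S l = concatMap (λ { (k , x) → scale k (S x) }) l

    -- S is the antipode: m ∘ (S ⊗ id) ∘ Δ = η ∘ ε = m ∘ (id ⊗ S) ∘ Δ
    -- (checked on the basis; S is the linear map with S(x) on basis x)
    IsAntipode : (Word → Lin) → Set ℓ
    IsAntipode S =
      (∀ x → concatMap (λ { (k , x₁ , x₂) → scale k (mulL (S x₁) ((1# , x₂) ∷ [])) }) (Δ x)
               ≈L (ε x , nothing) ∷ [])
      × (∀ x → concatMap (λ { (k , x₁ , x₂) → scale k (mulL ((1# , x₁) ∷ []) (S x₂)) }) (Δ x)
               ≈L (ε x , nothing) ∷ [])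

module Submission where

-- Pairing the antipode equation m ∘ (S ⊗ id) ∘ Δ = η ∘ ε with an arbitrary
-- function on basis words (two combinations are equal iff all such pairings
-- agree) gives Takeuchi's recursion S(x) = − x − Σ S(x₁) x₂, the sum running
-- over the terms D_A of Δ x with ∅ ≠ A ⊊ {1,…,n}; these are multilinear in the
-- tensor factors, so they can be evaluated on τ^⊗(n−1) directly.  If
-- ⟨τ,α⟩ = ⟨τ,β⟩ = 0, every such D_A vanishes because c_A contains the pairing
-- of τ at max A or at max B.  If ⟨τ,α⟩ = 1 and ⟨τ,β⟩ = 0, only A = {1,…,p+1}
-- survives and contributes S(τ^⊗p) ι τ^⊗q; by induction S(τ^⊗p) = − σ^⊗p with
-- σ = τ − ι, and Σ_{p+q=n−2} σ^⊗p ι τ^⊗q telescopes to τ^⊗(n−1) − σ^⊗(n−1).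

open import Defs
open import Level using (Level; 0ℓ; _⊔_)
open import Algebra.Bundles using (CommutativeRing)
open import Algebra.Bundles.Raw using (RawRing)
open import Data.Bool using (Bool; true; false; if_then_else_)
open import Data.Nat as ℕ using (ℕ; zero; suc; _≤_; _<_; s≤s)
import Data.Nat.Properties as ℕ
open import Data.Nat.Induction using (<-rec)
open import Data.Fin as Fin using (Fin)
open import Data.List using (List; []; _∷_; _++_; map; concatMap; length; replicate)
open import Data.List.Properties using (length-replicate)
open import Data.Maybe using (Maybe; nothing; just)
open import Data.Product using (_×_; _,_; proj₁; proj₂; ∃; ∃-syntax)
open import Relation.Nullary using (¬_; yes; no; does)
open import Data.Empty using (⊥-elim)
open import Relation.Binary.PropositionalEquality as ≡ using (_≡_)

-- Ring equations are normalised with coefficients in ℕ × ℕ, the pair (a , b)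
-- standing for a − b.  Equality of such coefficients is decidable
-- (a + d ≡ c + b), so the solver can cancel terms in any commutative ring.
module IntegerCoefficientSolver {c ℓ} (R : CommutativeRing c ℓ) where
  open CommutativeRing R
  open import Algebra.Properties.Ring ring using (-‿distribˡ-*; -‿distribʳ-*)
  open import Algebra.Properties.AbelianGroup +-abelianGroup
    using (⁻¹-∙-comm; ⁻¹-anti-homo‿-; ε⁻¹≈ε; ⁻¹-involutive)
  open import Algebra.Properties.Semiring.Mult.TCOptimised semiring
    using (×-homo-+; ×1-homo-*) renaming (_×_ to _×ₙ_)
  open import Algebra.Solver.Ring.AlmostCommutativeRing
    using (_-Raw-AlmostCommutative⟶_; Induced-equivalence; fromCommutativeRing)
  import Algebra.Solver.Ring.NaturalCoefficients.Default commutativeSemiring as Semiring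
  open import Relation.Binary.Reasoning.Setoid setoid

  differenceRing : RawRing 0ℓ 0ℓ
  differenceRing = record
    { Carrier = ℕ × ℕ ; _≈_ = _≡_
    ; _+_ = λ { (a , b) (c , d) → (a ℕ.+ c , b ℕ.+ d) }
    ; _*_ = λ { (a , b) (c , d) → (a ℕ.* c ℕ.+ b ℕ.* d , a ℕ.* d ℕ.+ b ℕ.* c) }
    ; -_ = λ { (a , b) → (b , a) }
    ; 0# = (0 , 0) ; 1# = (1 , 0) }

  [_] : ℕ → Carrier
  [ n ] = n ×ₙ 1#

  -- the case split keeps ⟦ n , 0 ⟧ definitionally equal to [ n ], so that
  -- the constants 0# and 1# of a solved equation need no rewriting
  ⟦_⟧ : ℕ × ℕ → Carrier
  ⟦ a , zero ⟧  = [ a ]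
  ⟦ a , suc b ⟧ = [ a ] - [ suc b ]

  ⟦⟧-difference : ∀ a b → ⟦ a , b ⟧ ≈ [ a ] - [ b ]
  ⟦⟧-difference a zero    = sym (trans (+-congˡ ε⁻¹≈ε) (+-identityʳ _))
  ⟦⟧-difference a (suc b) = refl

  -‿+-distrib : ∀ x y → - (x + y) ≈ - x + - y
  -‿+-distrib x y = sym (⁻¹-∙-comm x y)

  +-interchange : ∀ x y z w → (x + y) + (z + w) ≈ (x + z) + (y + w)
  +-interchange = Semiring.solve 4
    (λ x y z w → (x Semiring.:+ y) Semiring.:+ (z Semiring.:+ w)
           Semiring.:= (x Semiring.:+ z) Semiring.:+ (y Semiring.:+ w)) refl

  -‿+-interchange : ∀ x y z w → (x + z) - (y + w) ≈ (x - y) + (z - w)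
  -‿+-interchange x y z w = trans (+-congˡ (-‿+-distrib y w)) (+-interchange _ _ _ _)

  -‿*-interchange : ∀ x y z w → (x * z + y * w) - (x * w + y * z) ≈ (x - y) * (z - w)
  -‿*-interchange x y z w = begin
    (x * z + y * w) - (x * w + y * z)           ≈⟨ +-congˡ (-‿+-distrib _ _) ⟩
    (x * z + y * w) + (- (x * w) + - (y * z))   ≈⟨ +-cong (+-congˡ -y*-w) (+-cong (-‿distribʳ-* x w) (-‿distribˡ-* y z)) ⟩
    (x * z + - y * - w) + (x * - w + - y * z)   ≈⟨ Semiring.solve 4
        (λ x y z w → (x Semiring.:* z Semiring.:+ y Semiring.:* w) Semiring.:+ (x Semiring.:* w Semiring.:+ y Semiring.:* z)
               Semiring.:= (x Semiring.:+ y) Semiring.:* (z Semiring.:+ w)) refl x (- y) z (- w) ⟩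
    (x - y) * (z - w)                           ∎
    where
    -y*-w : y * w ≈ - y * - w
    -y*-w = begin
      y * w         ≈⟨ sym (⁻¹-involutive _) ⟩
      - - (y * w)   ≈⟨ -‿cong (-‿distribʳ-* y w) ⟩
      - (y * - w)   ≈⟨ -‿distribˡ-* y (- w) ⟩
      - y * - w     ∎

  embedding : differenceRing -Raw-AlmostCommutative⟶ fromCommutativeRing R
  embedding = record
    { ⟦_⟧    = ⟦_⟧
    ; +-homo = λ { (a , b) (c , d) → begin
        ⟦ a ℕ.+ c , b ℕ.+ d ⟧                ≈⟨ ⟦⟧-difference (a ℕ.+ c) (b ℕ.+ d) ⟩
        [ a ℕ.+ c ] - [ b ℕ.+ d ]             ≈⟨ +-cong (×-homo-+ 1# a c) (-‿cong (×-homo-+ 1# b d)) ⟩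
        ([ a ] + [ c ]) - ([ b ] + [ d ])     ≈⟨ -‿+-interchange _ _ _ _ ⟩
        ([ a ] - [ b ]) + ([ c ] - [ d ])     ≈⟨ sym (+-cong (⟦⟧-difference a b) (⟦⟧-difference c d)) ⟩
        ⟦ a , b ⟧ + ⟦ c , d ⟧                 ∎ }
    ; *-homo = λ { (a , b) (c , d) → begin
        ⟦ a ℕ.* c ℕ.+ b ℕ.* d , a ℕ.* d ℕ.+ b ℕ.* c ⟧   ≈⟨ ⟦⟧-difference (a ℕ.* c ℕ.+ b ℕ.* d) (a ℕ.* d ℕ.+ b ℕ.* c) ⟩
        [ a ℕ.* c ℕ.+ b ℕ.* d ] - [ a ℕ.* d ℕ.+ b ℕ.* c ]
          ≈⟨ +-cong (trans (×-homo-+ 1# (a ℕ.* c) (b ℕ.* d)) (+-cong (×1-homo-* a c) (×1-homo-* b d)))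
                    (-‿cong (trans (×-homo-+ 1# (a ℕ.* d) (b ℕ.* c)) (+-cong (×1-homo-* a d) (×1-homo-* b c)))) ⟩
        ([ a ] * [ c ] + [ b ] * [ d ]) - ([ a ] * [ d ] + [ b ] * [ c ])   ≈⟨ -‿*-interchange _ _ _ _ ⟩
        ([ a ] - [ b ]) * ([ c ] - [ d ])     ≈⟨ sym (*-cong (⟦⟧-difference a b) (⟦⟧-difference c d)) ⟩
        ⟦ a , b ⟧ * ⟦ c , d ⟧                 ∎ }
    ; -‿homo = λ { (a , b) → begin
        ⟦ b , a ⟧              ≈⟨ ⟦⟧-difference b a ⟩
        [ b ] - [ a ]          ≈⟨ sym (⁻¹-anti-homo‿- [ a ] [ b ]) ⟩
        - ([ a ] - [ b ])      ≈⟨ -‿cong (sym (⟦⟧-difference a b)) ⟩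
        - ⟦ a , b ⟧            ∎ }
    ; 0-homo = refl
    ; 1-homo = refl }

  +-cancelʳ-difference : ∀ x y z → (x + z) - (y + z) ≈ x - y
  +-cancelʳ-difference x y z = begin
    (x + z) - (y + z)   ≈⟨ -‿+-interchange _ _ _ _ ⟩
    (x - y) + (z - z)   ≈⟨ +-congˡ (-‿inverseʳ z) ⟩
    (x - y) + 0#        ≈⟨ +-identityʳ _ ⟩
    x - y               ∎

  differenceEquality? : ∀ p q → Maybe (Induced-equivalence embedding p q)
  differenceEquality? (a , b) (c , d) with a ℕ.+ d ℕ.≟ c ℕ.+ b
  ... | no _  = nothing
  ... | yes e = just (begin
    ⟦ a , b ⟧                          ≈⟨ ⟦⟧-difference a b ⟩
    [ a ] - [ b ]                      ≈⟨ sym (+-cancelʳ-difference _ _ [ d ]) ⟩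
    ([ a ] + [ d ]) - ([ b ] + [ d ])  ≈⟨ +-cong (sym (×-homo-+ 1# a d)) (-‿cong (+-comm _ _)) ⟩
    [ a ℕ.+ d ] - ([ d ] + [ b ])      ≈⟨ +-congʳ (trans (reflexive (≡.cong [_] e)) (×-homo-+ 1# c b)) ⟩
    ([ c ] + [ b ]) - ([ d ] + [ b ])  ≈⟨ +-cancelʳ-difference _ _ _ ⟩
    [ c ] - [ d ]                      ≈⟨ sym (⟦⟧-difference c d) ⟩
    ⟦ c , d ⟧                          ∎)

  open import Algebra.Solver.Ring differenceRing (fromCommutativeRing R) embedding differenceEquality? public
    using (solve; _:=_; _:+_; _:*_; :-_; _:-_; con)

module FiniteSums {c ℓ} (R : CommutativeRing c ℓ) where
  open CommutativeRing R
  open IntegerCoefficientSolver R using (+-interchange; -‿+-distrib)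
  open import Relation.Binary.Reasoning.Setoid setoid

  ∑ : ∀ {a} {A : Set a} → List A → (A → Carrier) → Carrier
  ∑ []       h = 0#
  ∑ (x ∷ xs) h = h x + ∑ xs h

  syntax ∑ xs (λ x → h) = ∑[ x ∈ xs ] h

  module _ {a} {A : Set a} where
    ∑-cong : ∀ (xs : List A) {h h′ : A → Carrier} → (∀ x → h x ≈ h′ x) → ∑ xs h ≈ ∑ xs h′
    ∑-cong []       e = refl
    ∑-cong (x ∷ xs) e = +-cong (e x) (∑-cong xs e)

    ∑-++ : ∀ (xs ys : List A) (h : A → Carrier) → ∑ (xs ++ ys) h ≈ ∑ xs h + ∑ ys h
    ∑-++ []       ys h = sym (+-identityˡ _)
    ∑-++ (x ∷ xs) ys h = trans (+-congˡ (∑-++ xs ys h)) (sym (+-assoc _ _ _))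

    ∑-+ : ∀ (xs : List A) (h h′ : A → Carrier) → ∑[ x ∈ xs ] (h x + h′ x) ≈ ∑ xs h + ∑ xs h′
    ∑-+ []       h h′ = sym (+-identityʳ _)
    ∑-+ (x ∷ xs) h h′ = trans (+-congˡ (∑-+ xs h h′)) (+-interchange _ _ _ _)

    ∑-*ˡ : ∀ (xs : List A) k (h : A → Carrier) → ∑[ x ∈ xs ] (k * h x) ≈ k * ∑ xs h
    ∑-*ˡ []       k h = sym (zeroʳ k)
    ∑-*ˡ (x ∷ xs) k h = trans (+-congˡ (∑-*ˡ xs k h)) (sym (distribˡ _ _ _))

    ∑-zero : ∀ (xs : List A) → ∑[ x ∈ xs ] 0# ≈ 0#
    ∑-zero []       = refl
    ∑-zero (x ∷ xs) = trans (+-identityˡ _) (∑-zero xs)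

  module _ {a b} {A : Set a} {B : Set b} where
    ∑-map : ∀ (f : A → B) xs (h : B → Carrier) → ∑ (map f xs) h ≡ ∑[ x ∈ xs ] h (f x)
    ∑-map f []       h = ≡.refl
    ∑-map f (x ∷ xs) h = ≡.cong (h (f x) +_) (∑-map f xs h)

    ∑-concatMap : ∀ (f : A → List B) xs (h : B → Carrier) → ∑ (concatMap f xs) h ≈ ∑[ x ∈ xs ] ∑ (f x) h
    ∑-concatMap f []       h = refl
    ∑-concatMap f (x ∷ xs) h = trans (∑-++ (f x) (concatMap f xs) h) (+-congˡ (∑-concatMap f xs h))

  ∑-antidiagonal : ℕ → (ℕ → ℕ → Carrier) → Carrier
  ∑-antidiagonal zero    f = f 0 0
  ∑-antidiagonal (suc n) f = f 0 (suc n) + ∑-antidiagonal n (λ p → f (suc p))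

  syntax ∑-antidiagonal n (λ p q → h) = ∑[ p + q ≡ n ] h

  ∑-antidiagonal-cong : ∀ n {f f′ : ℕ → ℕ → Carrier} →
    (∀ p q → p ℕ.+ q ≡ n → f p q ≈ f′ p q) → ∑-antidiagonal n f ≈ ∑-antidiagonal n f′
  ∑-antidiagonal-cong zero    e = e 0 0 ≡.refl
  ∑-antidiagonal-cong (suc n) e =
    +-cong (e 0 (suc n) ≡.refl) (∑-antidiagonal-cong n (λ p q p+q≡n → e (suc p) q (≡.cong suc p+q≡n)))

  ∑-antidiagonal-linear : ∀ n a b (f f′ : ℕ → ℕ → Carrier) →
    ∑[ p + q ≡ n ] (a * f p q + b * f′ p q) ≈ a * ∑-antidiagonal n f + b * ∑-antidiagonal n f′
  ∑-antidiagonal-linear zero    a b f f′ = refl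
  ∑-antidiagonal-linear (suc n) a b f f′ = begin
    (a * f 0 (suc n) + b * f′ 0 (suc n)) + ∑[ p + q ≡ n ] (a * f (suc p) q + b * f′ (suc p) q)
      ≈⟨ +-congˡ (∑-antidiagonal-linear n a b _ _) ⟩
    (a * f 0 (suc n) + b * f′ 0 (suc n)) + (a * ∑-antidiagonal n (λ p → f (suc p)) + b * ∑-antidiagonal n (λ p → f′ (suc p)))
      ≈⟨ +-interchange _ _ _ _ ⟩
    (a * f 0 (suc n) + a * ∑-antidiagonal n (λ p → f (suc p))) + (b * f′ 0 (suc n) + b * ∑-antidiagonal n (λ p → f′ (suc p)))
      ≈⟨ sym (+-cong (distribˡ _ _ _) (distribˡ _ _ _)) ⟩
    a * ∑-antidiagonal (suc n) f + b * ∑-antidiagonal (suc n) f′ ∎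

  ∑-antidiagonal-neg : ∀ n (f : ℕ → ℕ → Carrier) → ∑[ p + q ≡ n ] (- f p q) ≈ - ∑-antidiagonal n f
  ∑-antidiagonal-neg zero    f = refl
  ∑-antidiagonal-neg (suc n) f = trans (+-congˡ (∑-antidiagonal-neg n (λ p → f (suc p)))) (sym (-‿+-distrib _ _))

module TensorPairing {c ℓ} (R : CommutativeRing c ℓ) where
  open CommutativeRing R
  open IntegerCoefficientSolver R
  open FiniteSums R
  open import Relation.Binary.Reasoning.Setoid setoid

  ⟪_∣_⟫₁ : (Bool → Carrier) → (Bool → Carrier) → Carrier
  ⟪ f ∣ G ⟫₁ = f true * G true + f false * G false

  -- the pairing of the pure tensor f₁ ⊗ ⋯ ⊗ fₙ with a function Φ on Boolⁿ
  ⟪_∣_⟫ : List (Bool → Carrier) → (List Bool → Carrier) → Carrier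
  ⟪ []     ∣ Φ ⟫ = Φ []
  ⟪ f ∷ fs ∣ Φ ⟫ = ⟪ f ∣ (λ b → ⟪ fs ∣ (λ u → Φ (b ∷ u)) ⟫) ⟫₁

  ⟪⟫₁-cong : ∀ f {G G′ : Bool → Carrier} → (∀ b → G b ≈ G′ b) → ⟪ f ∣ G ⟫₁ ≈ ⟪ f ∣ G′ ⟫₁
  ⟪⟫₁-cong f e = +-cong (*-congˡ (e true)) (*-congˡ (e false))

  ⟪⟫₁-*ˡ : ∀ f k (G : Bool → Carrier) → k * ⟪ f ∣ G ⟫₁ ≈ ⟪ f ∣ (λ b → k * G b) ⟫₁
  ⟪⟫₁-*ˡ f k G = solve 5 (λ k p q x y → k :* (p :* x :+ q :* y) := p :* (k :* x) :+ q :* (k :* y))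
    refl k (f true) (f false) (G true) (G false)

  ⟪⟫₁-zero : ∀ f {G : Bool → Carrier} → (∀ b → G b ≈ 0#) → ⟪ f ∣ G ⟫₁ ≈ 0#
  ⟪⟫₁-zero f e = trans (⟪⟫₁-cong f e) (solve 2 (λ p q → p :* con (0 , 0) :+ q :* con (0 , 0) := con (0 , 0)) refl (f true) (f false))

  ⟪⟫₁-zeroˡ : ∀ {f} G → (∀ b → f b ≈ 0#) → ⟪ f ∣ G ⟫₁ ≈ 0#
  ⟪⟫₁-zeroˡ {f} G e = trans (+-cong (*-congʳ (e true)) (*-congʳ (e false)))
    (solve 2 (λ x y → con (0 , 0) :* x :+ con (0 , 0) :* y := con (0 , 0)) refl (G true) (G false))

  ∑-⟪⟫₁ : ∀ {a} {A : Set a} (xs : List A) f (h : Bool → A → Carrier) →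
    ∑[ x ∈ xs ] ⟪ f ∣ (λ b → h b x) ⟫₁ ≈ ⟪ f ∣ (λ b → ∑ xs (h b)) ⟫₁
  ∑-⟪⟫₁ xs f h = trans (∑-+ xs _ _) (+-cong (∑-*ˡ xs (f true) _) (∑-*ˡ xs (f false) _))

  ⟪⟫-cong : ∀ fs {Φ Φ′ : List Bool → Carrier} → (∀ u → length u ≡ length fs → Φ u ≈ Φ′ u) → ⟪ fs ∣ Φ ⟫ ≈ ⟪ fs ∣ Φ′ ⟫
  ⟪⟫-cong []       e = e [] ≡.refl
  ⟪⟫-cong (f ∷ fs) e = ⟪⟫₁-cong f (λ b → ⟪⟫-cong fs (λ u len → e (b ∷ u) (≡.cong suc len)))

  ⟪⟫-linear : ∀ fs a b (Φ Ψ : List Bool → Carrier) → ⟪ fs ∣ (λ u → a * Φ u + b * Ψ u) ⟫ ≈ a * ⟪ fs ∣ Φ ⟫ + b * ⟪ fs ∣ Ψ ⟫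
  ⟪⟫-linear []       a b Φ Ψ = refl
  ⟪⟫-linear (f ∷ fs) a b Φ Ψ = trans (⟪⟫₁-cong f (λ t → ⟪⟫-linear fs a b (λ u → Φ (t ∷ u)) (λ u → Ψ (t ∷ u))))
    (solve 8 (λ a b p q x y z w → p :* (a :* x :+ b :* y) :+ q :* (a :* z :+ b :* w)
                              := a :* (p :* x :+ q :* z) :+ b :* (p :* y :+ q :* w)) refl a b (f true) (f false) _ _ _ _)

  ⟪⟫-*ˡ : ∀ fs a (Φ : List Bool → Carrier) → ⟪ fs ∣ (λ u → a * Φ u) ⟫ ≈ a * ⟪ fs ∣ Φ ⟫
  ⟪⟫-*ˡ []       a Φ = refl
  ⟪⟫-*ˡ (f ∷ fs) a Φ = trans (⟪⟫₁-cong f (λ t → ⟪⟫-*ˡ fs a (λ u → Φ (t ∷ u))))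
    (solve 5 (λ a p q x z → p :* (a :* x) :+ q :* (a :* z) := a :* (p :* x :+ q :* z)) refl a (f true) (f false) _ _)

  ⟪⟫-+ : ∀ fs (Φ Ψ : List Bool → Carrier) → ⟪ fs ∣ (λ u → Φ u + Ψ u) ⟫ ≈ ⟪ fs ∣ Φ ⟫ + ⟪ fs ∣ Ψ ⟫
  ⟪⟫-+ []       Φ Ψ = refl
  ⟪⟫-+ (f ∷ fs) Φ Ψ = trans (⟪⟫₁-cong f (λ t → ⟪⟫-+ fs (λ u → Φ (t ∷ u)) (λ u → Ψ (t ∷ u))))
    (solve 6 (λ p q x y z w → p :* (x :+ y) :+ q :* (z :+ w) := (p :* x :+ q :* z) :+ (p :* y :+ q :* w))
      refl (f true) (f false) _ _ _ _)

  ⟪⟫-neg : ∀ fs (Φ : List Bool → Carrier) → ⟪ fs ∣ (λ u → - Φ u) ⟫ ≈ - ⟪ fs ∣ Φ ⟫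
  ⟪⟫-neg []       Φ = refl
  ⟪⟫-neg (f ∷ fs) Φ = trans (⟪⟫₁-cong f (λ t → ⟪⟫-neg fs (λ u → Φ (t ∷ u))))
    (solve 4 (λ p q x z → p :* (:- x) :+ q :* (:- z) := :- (p :* x :+ q :* z)) refl (f true) (f false) _ _)

  ⟪⟫-zero : ∀ fs → ⟪ fs ∣ (λ _ → 0#) ⟫ ≈ 0#
  ⟪⟫-zero []       = refl
  ⟪⟫-zero (f ∷ fs) = ⟪⟫₁-zero f (λ _ → ⟪⟫-zero fs)

  ⟪⟫-∑ : ∀ {a} {A : Set a} fs (xs : List A) (h : A → List Bool → Carrier) →
    ⟪ fs ∣ (λ u → ∑[ x ∈ xs ] h x u) ⟫ ≈ ∑[ x ∈ xs ] ⟪ fs ∣ h x ⟫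
  ⟪⟫-∑ fs []       h = ⟪⟫-zero fs
  ⟪⟫-∑ fs (x ∷ xs) h = trans (⟪⟫-+ fs (h x) _) (+-congˡ (⟪⟫-∑ fs xs h))

  ⟪⟫-swap : ∀ fs gs (H : List Bool → List Bool → Carrier) →
    ⟪ fs ∣ (λ u → ⟪ gs ∣ H u ⟫) ⟫ ≈ ⟪ gs ∣ (λ v → ⟪ fs ∣ (λ u → H u v) ⟫) ⟫
  ⟪⟫-swap []       gs H = refl
  ⟪⟫-swap (f ∷ fs) gs H = begin
    ⟪ f ∣ (λ t → ⟪ fs ∣ (λ u → ⟪ gs ∣ H (t ∷ u) ⟫) ⟫) ⟫₁  ≈⟨ ⟪⟫₁-cong f (λ t → ⟪⟫-swap fs gs (λ u → H (t ∷ u))) ⟩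
    ⟪ f ∣ (λ t → ⟪ gs ∣ (λ v → ⟪ fs ∣ (λ u → H (t ∷ u) v) ⟫) ⟫) ⟫₁  ≈⟨ sym (⟪⟫-linear gs (f true) (f false) _ _) ⟩
    ⟪ gs ∣ (λ v → ⟪ f ∷ fs ∣ (λ u → H u v) ⟫) ⟫  ∎

  module _ (τ ι : Bool → Carrier) where
    private
      σ : Bool → Carrier
      σ b = τ b - ι b

    ⟪⟫-telescope : ∀ N (Φ : List Bool → Carrier) →
      ∑[ p + q ≡ N ] ⟪ replicate p σ ∣ (λ u → ⟪ replicate q τ ∣ (λ v → ⟪ ι ∣ (λ b → Φ (u ++ b ∷ v)) ⟫₁) ⟫) ⟫
        ≈ ⟪ replicate (suc N) τ ∣ Φ ⟫ - ⟪ replicate (suc N) σ ∣ Φ ⟫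
    ⟪⟫-telescope zero Φ =
      solve 6 (λ τ₁ τ₀ ι₁ ι₀ x y → ι₁ :* x :+ ι₀ :* y := (τ₁ :* x :+ τ₀ :* y) :- ((τ₁ :- ι₁) :* x :+ (τ₀ :- ι₀) :* y))
        refl (τ true) (τ false) (ι true) (ι false) (Φ (true ∷ [])) (Φ (false ∷ []))
    ⟪⟫-telescope (suc N) Φ = begin
      ⟪ replicate (suc N) τ ∣ (λ v → ⟪ ι ∣ (λ b → Φ (b ∷ v)) ⟫₁) ⟫
        + ∑[ p + q ≡ N ] ⟪ σ ∷ replicate p σ ∣ (λ u → ⟪ replicate q τ ∣ (λ v → ⟪ ι ∣ (λ b → Φ (u ++ b ∷ v)) ⟫₁) ⟫) ⟫
          ≈⟨ +-cong (⟪⟫-linear (replicate (suc N) τ) (ι true) (ι false) (Φ ∘∷ true) (Φ ∘∷ false))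
                    (∑-antidiagonal-linear N (σ true) (σ false) _ _) ⟩
      (ι true * A true + ι false * A false)
        + (σ true * ∑[ p + q ≡ N ] _ + σ false * ∑[ p + q ≡ N ] _)
          ≈⟨ +-congˡ (+-cong (*-congˡ (⟪⟫-telescope N (Φ ∘∷ true))) (*-congˡ (⟪⟫-telescope N (Φ ∘∷ false)))) ⟩
      (ι true * A true + ι false * A false) + (σ true * (A true - B true) + σ false * (A false - B false))
          ≈⟨ solve 8 (λ τ₁ τ₀ ι₁ ι₀ a₁ a₀ b₁ b₀ →
                       (ι₁ :* a₁ :+ ι₀ :* a₀) :+ ((τ₁ :- ι₁) :* (a₁ :- b₁) :+ (τ₀ :- ι₀) :* (a₀ :- b₀))
                       := (τ₁ :* a₁ :+ τ₀ :* a₀) :- ((τ₁ :- ι₁) :* b₁ :+ (τ₀ :- ι₀) :* b₀))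
               refl (τ true) (τ false) (ι true) (ι false) (A true) (A false) (B true) (B false) ⟩
      ⟪ replicate (suc (suc N)) τ ∣ Φ ⟫ - ⟪ replicate (suc (suc N)) σ ∣ Φ ⟫ ∎
      where
      _∘∷_ : (List Bool → Carrier) → Bool → List Bool → Carrier
      (Ψ ∘∷ b) u = Ψ (b ∷ u)
      A B : Bool → Carrier
      A b = ⟪ replicate (suc N) τ ∣ Φ ∘∷ b ⟫
      B b = ⟪ replicate (suc N) σ ∣ Φ ∘∷ b ⟫

module LinearCombinations {c ℓ g ℓg : Level} (K : StarField c ℓ) (G : FiniteGroup g ℓg) where
  open StarField K
  open Setup K G
  open IntegerCoefficientSolver commutativeRing
  open FiniteSums commutativeRing
  open TensorPairing commutativeRing
  open import Algebra.Properties.Ring ring using (-1*x≈-x)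
  open import Relation.Binary.Reasoning.Setoid setoid

  evalLin : Lin → (Word → Carrier) → Carrier
  evalLin l F = ∑[ t ∈ l ] (proj₁ t * F (proj₂ t))

  evalLin-congʳ : ∀ l {F F′ : Word → Carrier} → (∀ x → F x ≈ F′ x) → evalLin l F ≈ evalLin l F′
  evalLin-congʳ l e = ∑-cong l (λ p → *-congˡ (e (proj₂ p)))

  evalLin-scale : ∀ k l F → evalLin (scale k l) F ≈ k * evalLin l F
  evalLin-scale k []            F = sym (zeroʳ k)
  evalLin-scale k ((a , w) ∷ l) F = trans (+-cong (*-assoc _ _ _) (evalLin-scale k l F)) (sym (distribˡ _ _ _))

  evalLin-++ : ∀ l l′ F → evalLin (l ++ l′) F ≈ evalLin l F + evalLin l′ F
  evalLin-++ l l′ F = ∑-++ l l′ _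

  indicator : Word → Word → Carrier
  indicator w x = if does (x ≟W w) then 1# else 0#

  coeff-evalLin : ∀ l w → coeff l w ≈ evalLin l (indicator w)
  coeff-evalLin []            w = refl
  coeff-evalLin ((k , u) ∷ l) w with u ≟W w
  ... | yes _ = +-cong (sym (*-identityʳ k)) (coeff-evalLin l w)
  ... | no _  = +-cong (sym (zeroʳ k)) (coeff-evalLin l w)

  coeff-++ : ∀ l l′ w → coeff (l ++ l′) w ≈ coeff l w + coeff l′ w
  coeff-++ l l′ w = begin
    coeff (l ++ l′) w                                    ≈⟨ coeff-evalLin (l ++ l′) w ⟩
    evalLin (l ++ l′) (indicator w)                      ≈⟨ evalLin-++ l l′ _ ⟩
    evalLin l (indicator w) + evalLin l′ (indicator w)   ≈⟨ sym (+-cong (coeff-evalLin l w) (coeff-evalLin l′ w)) ⟩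
    coeff l w + coeff l′ w                               ∎

  coeff-scale : ∀ k l w → coeff (scale k l) w ≈ k * coeff l w
  coeff-scale k l w = begin
    coeff (scale k l) w                 ≈⟨ coeff-evalLin (scale k l) w ⟩
    evalLin (scale k l) (indicator w)   ≈⟨ evalLin-scale k l _ ⟩
    k * evalLin l (indicator w)         ≈⟨ *-congˡ (sym (coeff-evalLin l w)) ⟩
    k * coeff l w                       ∎

  remove : Word → Lin → Lin
  remove y []            = []
  remove y ((a , x) ∷ l) = if does (x ≟W y) then remove y l else (a , x) ∷ remove y l

  evalLin-remove : ∀ y l F → evalLin l F ≈ coeff l y * F y + evalLin (remove y l) F
  evalLin-remove y []            F = sym (trans (+-congʳ (zeroˡ _)) (+-identityˡ _))
  evalLin-remove y ((a , x) ∷ l) F with x ≟W y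
  ... | yes ≡.refl = trans (+-congˡ (evalLin-remove x l F))
    (solve 4 (λ a b f r → a :* f :+ (b :* f :+ r) := (a :+ b) :* f :+ r) refl a (coeff l x) (F x) _)
  ... | no _ = trans (+-congˡ (evalLin-remove y l F))
    (solve 4 (λ p q f r → p :+ (q :* f :+ r) := (con (0 , 0) :+ q) :* f :+ (p :+ r)) refl (a * F x) (coeff l y) (F y) _)

  coeff-remove : ∀ y l w → ¬ y ≡ w → coeff (remove y l) w ≈ coeff l w
  coeff-remove y []            w y≢w = refl
  coeff-remove y ((a , x) ∷ l) w y≢w with x ≟W y
  ... | no _ = +-congˡ (coeff-remove y l w y≢w)
  ... | yes ≡.refl with x ≟W w
  ...   | yes x≡w = ⊥-elim (y≢w x≡w)
  ...   | no _    = trans (coeff-remove y l w y≢w) (sym (+-identityˡ _))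

  coeff-remove-self : ∀ y l → coeff (remove y l) y ≈ 0#
  coeff-remove-self y []            = refl
  coeff-remove-self y ((a , x) ∷ l) with x ≟W y
  ... | yes _ = coeff-remove-self y l
  ... | no x≢y with x ≟W y
  ...   | yes x≡y = ⊥-elim (x≢y x≡y)
  ...   | no _    = trans (+-identityˡ _) (coeff-remove-self y l)

  length-remove : ∀ y l → length (remove y l) ≤ length l
  length-remove y []            = ℕ.z≤n
  length-remove y ((a , x) ∷ l) with does (x ≟W y)
  ... | true  = ℕ.m≤n⇒m≤1+n (length-remove y l)
  ... | false = s≤s (length-remove y l)

  length-remove-head : ∀ y a l → length (remove y ((a , y) ∷ l)) ≤ length l
  length-remove-head y a l with y ≟W y
  ... | yes _  = length-remove y l
  ... | no y≢y = ⊥-elim (y≢y ≡.refl)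

  -- the recursion removes one word at a time, hence the bound on the length
  evalLin-vanishes : ∀ n l → length l ≤ n → (∀ w → coeff l w ≈ 0#) → ∀ F → evalLin l F ≈ 0#
  evalLin-vanishes n       []            _             _    F = refl
  evalLin-vanishes (suc n) ((a , y) ∷ l) (s≤s len≤n) coeff≈0 F = begin
    evalLin l′ F                                      ≈⟨ evalLin-remove y l′ F ⟩
    coeff l′ y * F y + evalLin (remove y l′) F
      ≈⟨ +-cong (trans (*-congʳ (coeff≈0 y)) (zeroˡ _))
                (evalLin-vanishes n (remove y l′) (ℕ.≤-trans (length-remove-head y a l) len≤n) removed≈0 F) ⟩
    0# + 0#                                           ≈⟨ +-identityˡ _ ⟩
    0#                                                ∎
    where
    l′ = (a , y) ∷ l
    removed≈0 : ∀ w → coeff (remove y l′) w ≈ 0#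
    removed≈0 w with y ≟W w
    ... | yes ≡.refl = coeff-remove-self y l′
    ... | no y≢w     = trans (coeff-remove y l′ w y≢w) (coeff≈0 w)

  evalLin-cong : ∀ l l′ → l ≈L l′ → ∀ F → evalLin l F ≈ evalLin l′ F
  evalLin-cong l l′ l≈l′ F = begin
    evalLin l F                                   ≈⟨ solve 2 (λ x y → x := (x :- y) :+ y) refl _ _ ⟩
    (evalLin l F - evalLin l′ F) + evalLin l′ F   ≈⟨ +-congʳ (+-congˡ (sym (trans (evalLin-scale (- 1#) l′ F) (-1*x≈-x _)))) ⟩
    (evalLin l F + evalLin (negL l′) F) + evalLin l′ F   ≈⟨ +-congʳ (sym (evalLin-++ l (negL l′) F)) ⟩
    evalLin (l ++ negL l′) F + evalLin l′ F        ≈⟨ +-congʳ (evalLin-vanishes _ (l ++ negL l′) ℕ.≤-refl difference≈0 F) ⟩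
    0# + evalLin l′ F                             ≈⟨ +-identityˡ _ ⟩
    evalLin l′ F                                  ∎
    where
    difference≈0 : ∀ w → coeff (l ++ negL l′) w ≈ 0#
    difference≈0 w = begin
      coeff (l ++ negL l′) w           ≈⟨ coeff-++ l (negL l′) w ⟩
      coeff l w + coeff (negL l′) w    ≈⟨ +-cong (l≈l′ w) (trans (coeff-scale (- 1#) l′ w) (-1*x≈-x _)) ⟩
      coeff l′ w - coeff l′ w          ≈⟨ -‿inverseʳ _ ⟩
      0#                               ∎

  ≈L-negL : ∀ l l′ → (∀ F → evalLin l F ≈ - evalLin l′ F) → l ≈L negL l′
  ≈L-negL l l′ h w = begin
    coeff l w                             ≈⟨ coeff-evalLin l w ⟩
    evalLin l (indicator w)               ≈⟨ h (indicator w) ⟩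
    - evalLin l′ (indicator w)            ≈⟨ sym (-1*x≈-x _) ⟩
    - 1# * evalLin l′ (indicator w)       ≈⟨ sym (evalLin-scale (- 1#) l′ _) ⟩
    evalLin (negL l′) (indicator w)       ≈⟨ sym (coeff-evalLin (negL l′) w) ⟩
    coeff (negL l′) w                     ∎

  ∑-allWords-suc : ∀ k (h : List Bool → Carrier) →
    ∑ (allWords (suc k)) h ≈ ∑[ w ∈ allWords k ] h (true ∷ w) + ∑[ w ∈ allWords k ] h (false ∷ w)
  ∑-allWords-suc k h = trans (∑-++ (map (true ∷_) (allWords k)) (map (false ∷_) (allWords k)) h)
    (+-cong (reflexive (∑-map (true ∷_) (allWords k) h)) (reflexive (∑-map (false ∷_) (allWords k) h)))

  ∑-allWords-cong : ∀ k {h h′ : List Bool → Carrier} → (∀ w → length w ≡ k → h w ≈ h′ w) →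
    ∑ (allWords k) h ≈ ∑ (allWords k) h′
  ∑-allWords-cong zero    e = +-congʳ (e [] ≡.refl)
  ∑-allWords-cong (suc k) {h} {h′} e = begin
    ∑ (allWords (suc k)) h                                                       ≈⟨ ∑-allWords-suc k h ⟩
    ∑[ w ∈ allWords k ] h (true ∷ w) + ∑[ w ∈ allWords k ] h (false ∷ w)
      ≈⟨ +-cong (∑-allWords-cong k (λ w len → e (true ∷ w) (≡.cong suc len)))
                (∑-allWords-cong k (λ w len → e (false ∷ w) (≡.cong suc len))) ⟩
    ∑[ w ∈ allWords k ] h′ (true ∷ w) + ∑[ w ∈ allWords k ] h′ (false ∷ w)    ≈⟨ sym (∑-allWords-suc k h′) ⟩
    ∑ (allWords (suc k)) h′                                                      ∎

  ∑-allWords-⟪⟫ : ∀ k f (Φ : List Bool → Carrier) →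
    ∑[ w ∈ allWords k ] (prodK (map f w) * Φ w) ≈ ⟪ replicate k f ∣ Φ ⟫
  ∑-allWords-⟪⟫ zero    f Φ = trans (+-identityʳ _) (*-identityˡ _)
  ∑-allWords-⟪⟫ (suc k) f Φ = trans (∑-allWords-suc k _) (+-cong (summand true) (summand false))
    where
    summand : ∀ b → ∑[ w ∈ allWords k ] ((f b * prodK (map f w)) * Φ (b ∷ w)) ≈ f b * ⟪ replicate k f ∣ (λ w → Φ (b ∷ w)) ⟫
    summand b = begin
      ∑[ w ∈ allWords k ] ((f b * prodK (map f w)) * Φ (b ∷ w))   ≈⟨ ∑-cong (allWords k) (λ w → *-assoc _ _ _) ⟩
      ∑[ w ∈ allWords k ] (f b * (prodK (map f w) * Φ (b ∷ w)))   ≈⟨ ∑-*ˡ (allWords k) (f b) _ ⟩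
      f b * ∑[ w ∈ allWords k ] (prodK (map f w) * Φ (b ∷ w))     ≈⟨ *-congˡ (∑-allWords-⟪⟫ k f (λ w → Φ (b ∷ w))) ⟩
      f b * ⟪ replicate k f ∣ (λ w → Φ (b ∷ w)) ⟫                  ∎

  evalLin-tensorPow : ∀ τ k F → evalLin (tensorPow τ (suc k)) F ≈ ⟪ replicate k τ ∣ (λ w → F (just w)) ⟫
  evalLin-tensorPow τ k F = trans (reflexive (∑-map (λ w → (prodK (map τ w) , just w)) (allWords k) _)) (∑-allWords-⟪⟫ k τ _)

  expand-⟪⟫ : ∀ fs (Φ : List Bool → Carrier) → ∑[ t ∈ expand fs ] (proj₁ t * Φ (proj₂ t)) ≈ ⟪ fs ∣ Φ ⟫
  expand-⟪⟫ []       Φ = trans (+-identityʳ _) (*-identityˡ _)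
  expand-⟪⟫ (f ∷ fs) Φ = begin
    ∑ (expand (f ∷ fs)) h                                      ≈⟨ ∑-concatMap _ (expand fs) h ⟩
    ∑[ t ∈ expand fs ] ((f true * proj₁ t) * Φ (true ∷ proj₂ t) + ((f false * proj₁ t) * Φ (false ∷ proj₂ t) + 0#))
      ≈⟨ ∑-cong (expand fs) (λ t → solve 5 (λ p q k x y → p :* k :* x :+ (q :* k :* y :+ con (0 , 0)) := p :* (k :* x) :+ q :* (k :* y))
                                              refl (f true) (f false) (proj₁ t) _ _) ⟩
    ∑[ t ∈ expand fs ] (f true * h (true ∷ᵗ t) + f false * h (false ∷ᵗ t))
      ≈⟨ trans (∑-+ (expand fs) _ _) (+-cong (∑-*ˡ (expand fs) (f true) _) (∑-*ˡ (expand fs) (f false) _)) ⟩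
    f true * ∑[ t ∈ expand fs ] h (true ∷ᵗ t) + f false * ∑[ t ∈ expand fs ] h (false ∷ᵗ t)
      ≈⟨ +-cong (*-congˡ (expand-⟪⟫ fs (λ u → Φ (true ∷ u)))) (*-congˡ (expand-⟪⟫ fs (λ u → Φ (false ∷ u)))) ⟩
    ⟪ f ∷ fs ∣ Φ ⟫                                             ∎
    where
    h : Carrier × List Bool → Carrier
    h t = proj₁ t * Φ (proj₂ t)
    _∷ᵗ_ : Bool → Carrier × List Bool → Carrier × List Bool
    b ∷ᵗ (k , u) = (k , b ∷ u)

  sumFin-cong : ∀ {n} (f f′ : Fin n → Carrier) → (∀ i → f i ≈ f′ i) → sumFin f ≈ sumFin f′
  sumFin-cong {zero}  f f′ e = refl
  sumFin-cong {suc n} f f′ e = +-cong (e Fin.zero) (sumFin-cong _ _ (λ i → e (Fin.suc i)))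

  ⟨⟩-congʳ : ∀ ψ {γ γ′} → (∀ b → γ b ≈ γ′ b) → ⟨ ψ , γ ⟩ ≈ ⟨ ψ , γ′ ⟩
  ⟨⟩-congʳ ψ {γ} {γ′} e = *-congˡ (sumFin-cong _ _ (λ i → *-congˡ (conj-cong (e (isOne (from i))))))
    where open FiniteGroup G using (isOne; from)

  ⟨⟩-expandˡ : ∀ ψ γ → ⟨ ψ , γ ⟩ ≈ ⟪ ψ ∣ (λ b → ⟨ δ b , γ ⟩) ⟫₁
  ⟨⟩-expandˡ ψ γ = trans (*-congˡ (sumFin-δ-split (λ i → FiniteGroup.isOne G (FiniteGroup.from G i)))) (solve 5
      (λ n p q x y → n :* (p :* x :+ q :* y) := p :* (n :* x) :+ q :* (n :* y)) refl _ (ψ true) (ψ false) _ _)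
    where
    split : ∀ (v : Bool → Carrier) b → ψ b * v b ≈ ψ true * (δ true b * v b) + ψ false * (δ false b * v b)
    split v true  = solve 3 (λ p q r → p :* r := p :* (con (1 , 0) :* r) :+ q :* (con (0 , 0) :* r)) refl (ψ true) (ψ false) (v true)
    split v false = solve 3 (λ p q r → q :* r := p :* (con (0 , 0) :* r) :+ q :* (con (1 , 0) :* r)) refl (ψ true) (ψ false) (v false)
    sumFin-δ-split : ∀ {n} (s : Fin n → Bool) → sumFin (λ i → ψ (s i) * conj (γ (s i)))
      ≈ ψ true * sumFin (λ i → δ true (s i) * conj (γ (s i))) + ψ false * sumFin (λ i → δ false (s i) * conj (γ (s i)))
    sumFin-δ-split {zero}  s = solve 2 (λ p q → con (0 , 0) := p :* con (0 , 0) :+ q :* con (0 , 0)) refl (ψ true) (ψ false)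
    sumFin-δ-split {suc n} s = trans (+-cong (split (λ b → conj (γ b)) (s Fin.zero)) (sumFin-δ-split (λ i → s (Fin.suc i))))
      (solve 6 (λ p q x y z w → (p :* x :+ q :* y) :+ (p :* z :+ q :* w) := p :* (x :+ z) :+ q :* (y :+ w)) refl (ψ true) (ψ false) _ _ _ _)

module CoproductTerms {c ℓ g ℓg : Level} (K : StarField c ℓ) (G : FiniteGroup g ℓg) (ι α β : Setup.SCF K G) where
  open StarField K
  open Setup K G
  open Hopf ι α β
  open IntegerCoefficientSolver commutativeRing
  open FiniteSums commutativeRing
  open TensorPairing commutativeRing
  open LinearCombinations K G
  open import Relation.Binary.Reasoning.Setoid setoid

  -- (u , v) ↦ the value of a functional on δ_u ⊗ δ_v ∈ H ⊗ H, for words u, v of degree ≥ 1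
  BiFunction : Set c
  BiFunction = List Bool → List Bool → Carrier

  shiftˡ shiftʳ : Bool → BiFunction → BiFunction
  shiftˡ b H u v = H (b ∷ u) v
  shiftʳ b H u v = H u (b ∷ v)

  -- φ_j and the factor of c_A for ψ_j = ψ, with j in block a and j+1 in block b (true = A)
  φ : SCF → Bool → Bool → SCF
  φ ψ a b = if eqB a b then ψ else (if a then (λ t → ⟨ ψ , α ⟩ * ι t) else (λ t → ⟨ ψ , β ⟩ * ι t))

  blockMaxFactor : SCF → Bool → Carrier
  blockMaxFactor ψ a = if a then ⟨ ψ , α ⟩ else ⟨ ψ , β ⟩

  -- one index j of D_A; the flag tells whether j's block continues after j,
  -- and r is the contribution of the indices after j
  evalDStep : SCF → Bool → Bool → Bool → (BiFunction → Carrier) → BiFunction → Carrier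
  evalDStep ψ a     b false r H = blockMaxFactor ψ a * r H
  evalDStep ψ true  b true  r H = ⟪ φ ψ true b ∣ (λ t → r (shiftˡ t H)) ⟫₁
  evalDStep ψ false b true  r H = ⟪ φ ψ false b ∣ (λ t → r (shiftʳ t H)) ⟫₁

  -- the value of H on D_A(ψ₁ ⊗ ⋯ ⊗ ψₙ₋₁), A given by its mask
  evalD : List SCF → List Bool → BiFunction → Carrier
  evalD (ψ ∷ ψs) (a ∷ b ∷ m) H = evalDStep ψ a b (occurs a (b ∷ m)) (evalD ψs (b ∷ m)) H
  evalD _        _           H = H [] []

  evalDTerm : Carrier × List SCF × List SCF → BiFunction → Carrier
  evalDTerm (c , L , R) H = c * ⟪ L ∣ (λ u → ⟪ R ∣ H u ⟫) ⟫

  evalDTerm-dTerm : ∀ w m H → evalDTerm (dTerm w m) H ≈ evalD (map δ w) m H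
  evalDTerm-dTerm []      m           H = *-identityˡ _
  evalDTerm-dTerm (x ∷ w) []          H = *-identityˡ _
  evalDTerm-dTerm (x ∷ w) (a ∷ [])    H = *-identityˡ _
  evalDTerm-dTerm (x ∷ w) (a ∷ b ∷ m) H with occurs a (b ∷ m) | dTerm w (b ∷ m) | evalDTerm-dTerm w (b ∷ m)
  ... | false | (c , L , R) | ih = trans (*-assoc _ _ _) (*-congˡ (ih H))
  evalDTerm-dTerm (x ∷ w) (true ∷ b ∷ m) H | true | (c , L , R) | ih =
    trans (⟪⟫₁-*ˡ (φ (δ x) true b) c (λ t → ⟪ L ∣ (λ u → ⟪ R ∣ H (t ∷ u) ⟫) ⟫)) (⟪⟫₁-cong (φ (δ x) true b) (λ t → ih (shiftˡ t H)))
  evalDTerm-dTerm (x ∷ w) (false ∷ b ∷ m) H | true | (c , L , R) | ih =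
    trans (*-congˡ (⟪⟫-linear L (φ′ true) (φ′ false) _ _))
      (trans (⟪⟫₁-*ˡ φ′ c (λ t → ⟪ L ∣ (λ u → ⟪ R ∣ (λ v → H u (t ∷ v)) ⟫) ⟫)) (⟪⟫₁-cong φ′ (λ t → ih (shiftʳ t H))))
    where φ′ = φ (δ x) false b

  ∑-D : ∀ w m (Q : Word → Word → Carrier) →
    ∑[ t ∈ D w m ] (proj₁ t * Q (proj₁ (proj₂ t)) (proj₂ (proj₂ t))) ≈ evalD (map δ w) m (λ u v → Q (just u) (just v))
  ∑-D w m Q with dTerm w m | evalDTerm-dTerm w m (λ u v → Q (just u) (just v))
  ... | (c , L , R) | dTerm≈evalD = begin
    ∑ (concatMap pairsWith (expand L)) h                                   ≈⟨ ∑-concatMap pairsWith (expand L) h ⟩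
    ∑[ s ∈ expand L ] ∑ (pairsWith s) h                                    ≈⟨ ∑-cong (expand L) (λ s → row (proj₁ s) (proj₂ s)) ⟩
    ∑[ s ∈ expand L ] (c * (proj₁ s * ⟪ R ∣ Q′ (proj₂ s) ⟫))               ≈⟨ ∑-*ˡ (expand L) c _ ⟩
    c * ∑[ s ∈ expand L ] (proj₁ s * ⟪ R ∣ Q′ (proj₂ s) ⟫)                 ≈⟨ *-congˡ (expand-⟪⟫ L _) ⟩
    c * ⟪ L ∣ (λ u → ⟪ R ∣ Q′ u ⟫) ⟫                                       ≈⟨ dTerm≈evalD ⟩
    evalD (map δ w) m (λ u v → Q (just u) (just v))                        ∎
    where
    Q′ : BiFunction
    Q′ u v = Q (just u) (just v)
    h : Carrier × Word × Word → Carrier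
    h t = proj₁ t * Q (proj₁ (proj₂ t)) (proj₂ (proj₂ t))
    pairsWith : Carrier × List Bool → List (Carrier × Word × Word)
    pairsWith (k , u) = map (λ { (k′ , v) → (c * k * k′ , just u , just v) }) (expand R)
    row : ∀ k u → ∑ (pairsWith (k , u)) h ≈ c * (k * ⟪ R ∣ Q′ u ⟫)
    row k u = begin
      ∑ (pairsWith (k , u)) h                                   ≈⟨ reflexive (∑-map _ (expand R) h) ⟩
      ∑[ s ∈ expand R ] ((c * k * proj₁ s) * Q′ u (proj₂ s))
        ≈⟨ ∑-cong (expand R) (λ s → solve 4 (λ c k k′ q → c :* k :* k′ :* q := (c :* k) :* (k′ :* q)) refl c k (proj₁ s) _) ⟩
      ∑[ s ∈ expand R ] ((c * k) * (proj₁ s * Q′ u (proj₂ s)))  ≈⟨ ∑-*ˡ (expand R) (c * k) _ ⟩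
      (c * k) * ∑[ s ∈ expand R ] (proj₁ s * Q′ u (proj₂ s))    ≈⟨ *-congˡ (expand-⟪⟫ R (Q′ u)) ⟩
      (c * k) * ⟪ R ∣ Q′ u ⟫                                    ≈⟨ *-assoc _ _ _ ⟩
      c * (k * ⟪ R ∣ Q′ u ⟫)                                    ∎

  ⟪⟫-evalDStep : ∀ fs ψ a b o (rs : List Bool → BiFunction → Carrier) (r : BiFunction → Carrier) H →
    (∀ H′ → ⟪ fs ∣ (λ w → rs w H′) ⟫ ≈ r H′) → ⟪ fs ∣ (λ w → evalDStep ψ a b o (rs w) H) ⟫ ≈ evalDStep ψ a b o r H
  ⟪⟫-evalDStep fs ψ a     b false rs r H e = trans (⟪⟫-*ˡ fs (blockMaxFactor ψ a) _) (*-congˡ (e H))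
  ⟪⟫-evalDStep fs ψ true  b true  rs r H e =
    trans (⟪⟫-linear fs (φ ψ true b true) (φ ψ true b false) _ _) (+-cong (*-congˡ (e _)) (*-congˡ (e _)))
  ⟪⟫-evalDStep fs ψ false b true  rs r H e =
    trans (⟪⟫-linear fs (φ ψ false b true) (φ ψ false b false) _ _) (+-cong (*-congˡ (e _)) (*-congˡ (e _)))

  private
    factorOut : ∀ p q a b x → p * (a * x) + q * (b * x) ≈ (p * a + q * b) * x
    factorOut = solve 5 (λ p q a b x → p :* (a :* x) :+ q :* (b :* x) := (p :* a :+ q :* b) :* x) refl

    factorOut₂ : ∀ p q a b i j x y → p * ((a * i) * x + (a * j) * y) + q * ((b * i) * x + (b * j) * y)
                                     ≈ ((p * a + q * b) * i) * x + ((p * a + q * b) * j) * y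
    factorOut₂ = solve 8 (λ p q a b i j x y → p :* ((a :* i) :* x :+ (a :* j) :* y) :+ q :* ((b :* i) :* x :+ (b :* j) :* y)
                                               := ((p :* a :+ q :* b) :* i) :* x :+ ((p :* a :+ q :* b) :* j) :* y) refl

    δ-pairing : ∀ p q x y → p * (1# * x + 0# * y) + q * (0# * x + 1# * y) ≈ p * x + q * y
    δ-pairing = solve 4 (λ p q x y → p :* (con (1 , 0) :* x :+ con (0 , 0) :* y) :+ q :* (con (0 , 0) :* x :+ con (1 , 0) :* y)
                                     := p :* x :+ q :* y) refl

  ⟪⟫₁-evalDStep : ∀ f a b o (r : BiFunction → Carrier) H → ⟪ f ∣ (λ x → evalDStep (δ x) a b o r H) ⟫₁ ≈ evalDStep f a b o r H
  ⟪⟫₁-evalDStep f true  b     false r H = trans (factorOut _ _ _ _ _) (*-congʳ (sym (⟨⟩-expandˡ f α)))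
  ⟪⟫₁-evalDStep f false b     false r H = trans (factorOut _ _ _ _ _) (*-congʳ (sym (⟨⟩-expandˡ f β)))
  ⟪⟫₁-evalDStep f true  true  true  r H = δ-pairing _ _ _ _
  ⟪⟫₁-evalDStep f false false true  r H = δ-pairing _ _ _ _
  ⟪⟫₁-evalDStep f true  false true  r H =
    trans (factorOut₂ _ _ _ _ _ _ _ _) (+-cong (*-congʳ (*-congʳ (sym (⟨⟩-expandˡ f α)))) (*-congʳ (*-congʳ (sym (⟨⟩-expandˡ f α)))))
  ⟪⟫₁-evalDStep f false true  true  r H =
    trans (factorOut₂ _ _ _ _ _ _ _ _) (+-cong (*-congʳ (*-congʳ (sym (⟨⟩-expandˡ f β)))) (*-congʳ (*-congʳ (sym (⟨⟩-expandˡ f β)))))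

  ⟪⟫-evalD : ∀ fs m H → length m ≡ suc (length fs) → ⟪ fs ∣ (λ w → evalD (map δ w) m H) ⟫ ≈ evalD fs m H
  ⟪⟫-evalD []       m           H _   = refl
  ⟪⟫-evalD (f ∷ fs) (a ∷ b ∷ m) H len =
    trans (⟪⟫₁-cong f (λ x → ⟪⟫-evalDStep fs (δ x) a b (occurs a (b ∷ m)) _ (evalD fs (b ∷ m)) H
                              (λ H′ → ⟪⟫-evalD fs (b ∷ m) H′ (ℕ.suc-injective len))))
          (⟪⟫₁-evalDStep f a b (occurs a (b ∷ m)) (evalD fs (b ∷ m)) H)

  occurs-true⇒¬allFalse : ∀ l → occurs true l ≡ true → allFalse l ≡ false
  occurs-true⇒¬allFalse (true  ∷ l) _  = ≡.refl
  occurs-true⇒¬allFalse (false ∷ l) oc = occurs-true⇒¬allFalse l oc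

  occurs-false⇒¬allTrue : ∀ l → occurs false l ≡ true → allTrue l ≡ false
  occurs-false⇒¬allTrue (false ∷ l) _  = ≡.refl
  occurs-false⇒¬allTrue (true  ∷ l) oc = occurs-false⇒¬allTrue l oc

  ¬occurs-true⇒allFalse : ∀ l → occurs true l ≡ false → allFalse l ≡ true
  ¬occurs-true⇒allFalse []          _   = ≡.refl
  ¬occurs-true⇒allFalse (false ∷ l) ¬oc = ¬occurs-true⇒allFalse l ¬oc

  ifProper : List Bool → List (List Bool)
  ifProper m = if allTrue m then [] else (if allFalse m then [] else m ∷ [])

  ∑-properMasks : ∀ n (h : List Bool → Carrier) → ∑ (properMasks n) h ≈ ∑[ m ∈ allWords n ] ∑ (ifProper m) h
  ∑-properMasks n h = ∑-concatMap ifProper (allWords n) h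

  ∑-ifProper-cong : ∀ m {h h′ : List Bool → Carrier} → h m ≈ h′ m → ∑ (ifProper m) h ≈ ∑ (ifProper m) h′
  ∑-ifProper-cong m e with allTrue m | allFalse m
  ... | true  | _     = refl
  ... | false | true  = refl
  ... | false | false = +-congʳ e

  ∑-properMasks-cong : ∀ n {h h′ : List Bool → Carrier} → (∀ m → length m ≡ n → h m ≈ h′ m) →
    ∑ (properMasks n) h ≈ ∑ (properMasks n) h′
  ∑-properMasks-cong n e = begin
    ∑ (properMasks n) _                      ≈⟨ ∑-properMasks n _ ⟩
    ∑[ m ∈ allWords n ] ∑ (ifProper m) _     ≈⟨ ∑-allWords-cong n (λ m len → ∑-ifProper-cong m (e m len)) ⟩
    ∑[ m ∈ allWords n ] ∑ (ifProper m) _     ≈⟨ sym (∑-properMasks n _) ⟩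
    ∑ (properMasks n) _                      ∎

  ¬allTrue-tail : ∀ a l → occurs a l ≡ true → allTrue (a ∷ l) ≡ false → allTrue l ≡ false
  ¬allTrue-tail true  l _  h = h
  ¬allTrue-tail false l oc _ = occurs-false⇒¬allTrue l oc

  ¬allFalse-tail : ∀ a l → occurs a l ≡ true → allFalse (a ∷ l) ≡ false → allFalse l ≡ false
  ¬allFalse-tail false l _  h = h
  ¬allFalse-tail true  l oc _ = occurs-true⇒¬allFalse l oc

  -- For proper A, max A or max B is not n and contributes ⟨τ,α⟩ or ⟨τ,β⟩ to c_A.
  module _ {τ : SCF} (⟨τ,α⟩≈0 : ⟨ τ , α ⟩ ≈ 0#) (⟨τ,β⟩≈0 : ⟨ τ , β ⟩ ≈ 0#) where
    evalDStep-vanishes : ∀ a b o (r : BiFunction → Carrier) H → (o ≡ true → ∀ H′ → r H′ ≈ 0#) → evalDStep τ a b o r H ≈ 0#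
    evalDStep-vanishes true  b false r H _ = trans (*-congʳ ⟨τ,α⟩≈0) (zeroˡ _)
    evalDStep-vanishes false b false r H _ = trans (*-congʳ ⟨τ,β⟩≈0) (zeroˡ _)
    evalDStep-vanishes true  b true  r H e = ⟪⟫₁-zero (φ τ true b) (λ t → e ≡.refl (shiftˡ t H))
    evalDStep-vanishes false b true  r H e = ⟪⟫₁-zero (φ τ false b) (λ t → e ≡.refl (shiftʳ t H))

    evalD-properMask≈0 : ∀ n m H → length m ≡ suc n → allTrue m ≡ false → allFalse m ≡ false → evalD (replicate n τ) m H ≈ 0#
    evalD-properMask≈0 zero    (true  ∷ [])    H _   ()      _
    evalD-properMask≈0 zero    (false ∷ [])    H _   _       ()
    evalD-properMask≈0 (suc n) (a ∷ b ∷ m)     H len ¬allT ¬allF =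
      evalDStep-vanishes a b (occurs a (b ∷ m)) (evalD (replicate n τ) (b ∷ m)) H (λ oc H′ →
        evalD-properMask≈0 n (b ∷ m) H′ (ℕ.suc-injective len) (¬allTrue-tail a (b ∷ m) oc ¬allT) (¬allFalse-tail a (b ∷ m) oc ¬allF))
    evalD-properMask≈0 zero    []              H ()
    evalD-properMask≈0 zero    (_ ∷ _ ∷ _)     H ()
    evalD-properMask≈0 (suc n) []              H ()
    evalD-properMask≈0 (suc n) (_ ∷ [])        H ()

    ∑-properMasks-evalD≈0 : ∀ k H → ∑[ m ∈ properMasks (suc k) ] evalD (replicate k τ) m H ≈ 0#
    ∑-properMasks-evalD≈0 k H = trans (∑-properMasks (suc k) _)
      (trans (∑-allWords-cong (suc k) properTerm≈0) (∑-zero (allWords (suc k))))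
      where
      properTerm≈0 : ∀ m → length m ≡ suc k → ∑[ m′ ∈ ifProper m ] evalD (replicate k τ) m′ H ≈ 0#
      properTerm≈0 m len with allTrue m in allT | allFalse m in allF
      ... | true  | _     = refl
      ... | false | true  = refl
      ... | false | false = trans (+-identityʳ _) (evalD-properMask≈0 k m H len allT allF)

  ∑-allWords-allFalse : ∀ n (X : List Bool → Carrier) →
    ∑[ m ∈ allWords n ] (if allFalse m then X m else 0#) ≈ X (replicate n false)
  ∑-allWords-allFalse zero    X = +-identityʳ _
  ∑-allWords-allFalse (suc n) X = trans (∑-allWords-suc n _)
    (trans (+-cong (∑-zero (allWords n)) (∑-allWords-allFalse n (λ m → X (false ∷ m)))) (+-identityˡ _))

  -- Here the surviving D_A are those with A = {1, …, p+1}: an index of B followed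
  -- by one of A gives φ_j = ⟨τ,β⟩ ι = 0, and the maxima contribute ⟨τ,α⟩ = 1.
  module _ {τ : SCF} (⟨τ,α⟩≈1 : ⟨ τ , α ⟩ ≈ 1#) (⟨τ,β⟩≈0 : ⟨ τ , β ⟩ ≈ 0#) where
    evalD-false∷¬allFalse≈0 : ∀ k m H → length m ≡ k → allFalse m ≡ false → evalD (replicate k τ) (false ∷ m) H ≈ 0#
    evalD-false∷¬allFalse≈0 zero    []          H _   ()
    evalD-false∷¬allFalse≈0 (suc k) (false ∷ m) H len ¬allF =
      ⟪⟫₁-zero τ (λ t → evalD-false∷¬allFalse≈0 k m (shiftʳ t H) (ℕ.suc-injective len) ¬allF)
    evalD-false∷¬allFalse≈0 (suc k) (true ∷ m)  H len ¬allF with occurs false m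
    ... | false = trans (*-congʳ ⟨τ,β⟩≈0) (zeroˡ _)
    ... | true  = ⟪⟫₁-zeroˡ (λ t → evalD (replicate k τ) (true ∷ m) (shiftʳ t H)) (λ t → trans (*-congʳ ⟨τ,β⟩≈0) (zeroˡ (ι t)))
    evalD-false∷¬allFalse≈0 zero    (_ ∷ _)     H ()
    evalD-false∷¬allFalse≈0 (suc k) []          H ()

    evalD-allFalse : ∀ n H → evalD (replicate n τ) (replicate (suc n) false) H ≈ ⟪ replicate n τ ∣ H [] ⟫
    evalD-allFalse zero    H = refl
    evalD-allFalse (suc n) H = ⟪⟫₁-cong τ (λ t → evalD-allFalse n (shiftʳ t H))

    properTerm : ℕ → BiFunction → List Bool → Carrier
    properTerm k H m = ∑[ m′ ∈ ifProper m ] evalD (replicate k τ) m′ H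

    properTerm-false∷≈0 : ∀ k m H → length m ≡ k → properTerm k H (false ∷ m) ≈ 0#
    properTerm-false∷≈0 k m H len with allFalse m in allF
    ... | true  = refl
    ... | false = trans (+-identityʳ _) (evalD-false∷¬allFalse≈0 k m H len allF)

    properTerm-true∷ : ∀ k m H → length m ≡ suc k →
      properTerm (suc k) H (true ∷ m) ≈ ⟪ τ ∣ (λ t → properTerm k (shiftˡ t H) m) ⟫₁ + (if allFalse m then evalD (replicate k τ) m H else 0#)
    properTerm-true∷ k (true ∷ m) H len with allTrue m
    ... | true  = sym (trans (+-identityʳ _) (⟪⟫₁-zero τ (λ _ → refl)))
    ... | false = trans (+-identityʳ _) (sym (trans (+-identityʳ _) (⟪⟫₁-cong τ {G′ = λ t → evalD (replicate k τ) (true ∷ m) (shiftˡ t H)} (λ _ → +-identityʳ _))))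
    properTerm-true∷ k (false ∷ m) H len with occurs true m in oc | allFalse m in allF
    ... | true  | true  with () ← ≡.trans (≡.sym allF) (occurs-true⇒¬allFalse m oc)
    ... | false | false with () ← ≡.trans (≡.sym allF) (¬occurs-true⇒allFalse m oc)
    ... | true  | false = +-congʳ (trans (⟪⟫₁-zero (φ τ true false) vanishes)
                                         (sym (⟪⟫₁-zero τ (λ t → trans (+-identityʳ _) (vanishes t)))))
      where
      vanishes : ∀ t → evalD (replicate k τ) (false ∷ m) (shiftˡ t H) ≈ 0#
      vanishes t = evalD-false∷¬allFalse≈0 k m (shiftˡ t H) (ℕ.suc-injective len) allF
    ... | false | true  = begin
      ⟨ τ , α ⟩ * evalD (replicate k τ) (false ∷ m) H + 0#   ≈⟨ +-identityʳ _ ⟩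
      ⟨ τ , α ⟩ * evalD (replicate k τ) (false ∷ m) H        ≈⟨ trans (*-congʳ ⟨τ,α⟩≈1) (*-identityˡ _) ⟩
      evalD (replicate k τ) (false ∷ m) H                    ≈⟨ sym (+-identityˡ _) ⟩
      0# + evalD (replicate k τ) (false ∷ m) H               ≈⟨ +-congʳ (sym (⟪⟫₁-zero τ (λ _ → refl))) ⟩
      ⟪ τ ∣ (λ _ → 0#) ⟫₁ + evalD (replicate k τ) (false ∷ m) H ∎

    properMaskSum : ℕ → BiFunction → Carrier
    properMaskSum k H = ∑[ m ∈ properMasks (suc k) ] evalD (replicate k τ) m H

    properMaskSum-suc : ∀ k H → properMaskSum (suc k) H ≈ ⟪ τ ∣ (λ t → properMaskSum k (shiftˡ t H)) ⟫₁ + ⟪ replicate k τ ∣ H [] ⟫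
    properMaskSum-suc k H = begin
      properMaskSum (suc k) H                                                     ≈⟨ ∑-properMasks (suc (suc k)) _ ⟩
      ∑ (allWords (suc (suc k))) (properTerm (suc k) H)                          ≈⟨ ∑-allWords-suc (suc k) _ ⟩
      ∑[ m ∈ W ] properTerm (suc k) H (true ∷ m) + ∑[ m ∈ W ] properTerm (suc k) H (false ∷ m)
        ≈⟨ +-cong (∑-allWords-cong (suc k) (λ m len → properTerm-true∷ k m H len))
                  (trans (∑-allWords-cong (suc k) (λ m len → properTerm-false∷≈0 (suc k) m H len)) (∑-zero W)) ⟩
      ∑[ m ∈ W ] (⟪ τ ∣ (λ t → properTerm k (shiftˡ t H) m) ⟫₁ + (if allFalse m then evalD (replicate k τ) m H else 0#)) + 0#
        ≈⟨ trans (+-identityʳ _) (∑-+ W _ _) ⟩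
      ∑[ m ∈ W ] ⟪ τ ∣ (λ t → properTerm k (shiftˡ t H) m) ⟫₁ + ∑[ m ∈ W ] (if allFalse m then evalD (replicate k τ) m H else 0#)
        ≈⟨ +-cong (∑-⟪⟫₁ W τ (λ t → properTerm k (shiftˡ t H))) (∑-allWords-allFalse (suc k) (λ m → evalD (replicate k τ) m H)) ⟩
      ⟪ τ ∣ (λ t → ∑ W (properTerm k (shiftˡ t H))) ⟫₁ + evalD (replicate k τ) (replicate (suc k) false) H
        ≈⟨ +-cong (⟪⟫₁-cong τ (λ t → sym (∑-properMasks (suc k) (λ m → evalD (replicate k τ) m (shiftˡ t H))))) (evalD-allFalse k H) ⟩
      ⟪ τ ∣ (λ t → properMaskSum k (shiftˡ t H)) ⟫₁ + ⟪ replicate k τ ∣ H [] ⟫   ∎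
      where W = allWords (suc k)

    splitPairing : ℕ → BiFunction → Carrier
    splitPairing zero    H = 0#
    splitPairing (suc k) H = ∑[ p + q ≡ k ] ⟪ replicate p τ ∣ (λ u → ⟪ replicate q τ ∣ H u ⟫) ⟫

    splitPairing-suc : ∀ k H → splitPairing (suc k) H ≈ ⟪ τ ∣ (λ t → splitPairing k (shiftˡ t H)) ⟫₁ + ⟪ replicate k τ ∣ H [] ⟫
    splitPairing-suc zero    H = sym (trans (+-congʳ (⟪⟫₁-zero τ (λ _ → refl))) (+-identityˡ _))
    splitPairing-suc (suc k) H = trans (+-congˡ (∑-antidiagonal-linear k (τ true) (τ false) _ _)) (+-comm _ _)

    properMaskSum≈splitPairing : ∀ k H → properMaskSum k H ≈ splitPairing k H
    properMaskSum≈splitPairing zero    H = refl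
    properMaskSum≈splitPairing (suc k) H = begin
      properMaskSum (suc k) H                                                     ≈⟨ properMaskSum-suc k H ⟩
      ⟪ τ ∣ (λ t → properMaskSum k (shiftˡ t H)) ⟫₁ + ⟪ replicate k τ ∣ H [] ⟫    ≈⟨ +-congʳ (⟪⟫₁-cong τ (λ t → properMaskSum≈splitPairing k (shiftˡ t H))) ⟩
      ⟪ τ ∣ (λ t → splitPairing k (shiftˡ t H)) ⟫₁ + ⟪ replicate k τ ∣ H [] ⟫     ≈⟨ sym (splitPairing-suc k H) ⟩
      splitPairing (suc k) H                                                      ∎

module AntipodeRecursion {c ℓ g ℓg : Level} (K : StarField c ℓ) (G : FiniteGroup g ℓg) (ι α β : Setup.SCF K G)
    (S : Setup.Word K G → Setup.Lin K G) (S-antipode : Setup.Hopf.IsAntipode K G ι α β S) where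
  open StarField K
  open Setup K G
  open Hopf ι α β
  open IntegerCoefficientSolver commutativeRing
  open FiniteSums commutativeRing
  open TensorPairing commutativeRing
  open LinearCombinations K G
  open CoproductTerms K G ι α β
  open import Relation.Binary.Reasoning.Setoid setoid

  rightMul : Word → (Word → Carrier) → Word → Carrier
  rightMul y F x = evalLin (mulB x y) F

  atSProduct : (Word → Carrier) → Word → Word → Carrier
  atSProduct F x₁ x₂ = evalLin (S x₁) (rightMul x₂ F)

  atSProducts : (Word → Carrier) → BiFunction
  atSProducts F u v = atSProduct F (just u) (just v)

  rightMul-unit : ∀ F x → rightMul nothing F x ≈ F x
  rightMul-unit F nothing  = trans (+-identityʳ _) (*-identityˡ _)
  rightMul-unit F (just u) = trans (+-identityʳ _) (*-identityˡ _)

  evalLin-mulL : ∀ l y F → evalLin (mulL l ((1# , y) ∷ [])) F ≈ evalLin l (rightMul y F)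
  evalLin-mulL []            y F = refl
  evalLin-mulL ((a , x) ∷ l) y F = begin
    evalLin ((scale (a * 1#) (mulB x y) ++ []) ++ mulL l ((1# , y) ∷ [])) F
      ≈⟨ evalLin-++ (scale (a * 1#) (mulB x y) ++ []) _ F ⟩
    evalLin (scale (a * 1#) (mulB x y) ++ []) F + evalLin (mulL l ((1# , y) ∷ [])) F
      ≈⟨ +-cong (trans (evalLin-++ (scale (a * 1#) (mulB x y)) [] F) (+-identityʳ _)) (evalLin-mulL l y F) ⟩
    evalLin (scale (a * 1#) (mulB x y)) F + evalLin l (rightMul y F)
      ≈⟨ +-congʳ (trans (evalLin-scale (a * 1#) (mulB x y) F) (*-congʳ (*-identityʳ a))) ⟩
    a * rightMul y F x + evalLin l (rightMul y F) ∎

  antipode-evaluated : ∀ x F →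
    ∑[ t ∈ Δ x ] (proj₁ t * atSProduct F (proj₁ (proj₂ t)) (proj₂ (proj₂ t))) ≈ ε x * F nothing + 0#
  antipode-evaluated x F =
    evaluate (proj₁ S-antipode x) (λ k x₁ x₂ →
      trans (evalLin-scale k (mulL (S x₁) ((1# , x₂) ∷ [])) F) (*-congˡ (evalLin-mulL (S x₁) x₂ F)))
    where
    h : Carrier × Word × Word → Carrier
    h t = proj₁ t * atSProduct F (proj₁ (proj₂ t)) (proj₂ (proj₂ t))
    evaluate : ∀ {f} → concatMap f (Δ x) ≈L (ε x , nothing) ∷ [] →
      (∀ k x₁ x₂ → evalLin (f (k , x₁ , x₂)) F ≈ k * atSProduct F x₁ x₂) → ∑ (Δ x) h ≈ ε x * F nothing + 0#
    evaluate {f} f≈ε pointwise = begin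
      ∑ (Δ x) h                          ≈⟨ sym (∑-cong (Δ x) (λ { (k , x₁ , x₂) → pointwise k x₁ x₂ })) ⟩
      ∑[ t ∈ Δ x ] evalLin (f t) F       ≈⟨ sym (∑-concatMap f (Δ x) _) ⟩
      evalLin (concatMap f (Δ x)) F      ≈⟨ evalLin-cong (concatMap f (Δ x)) ((ε x , nothing) ∷ []) f≈ε F ⟩
      ε x * F nothing + 0#               ∎

  S-unit : ∀ F → evalLin (S nothing) F ≈ F nothing
  S-unit F = begin
    evalLin (S nothing) F                          ≈⟨ sym (evalLin-congʳ (S nothing) (rightMul-unit F)) ⟩
    atSProduct F nothing nothing                   ≈⟨ sym (trans (+-identityʳ _) (*-identityˡ _)) ⟩
    1# * atSProduct F nothing nothing + 0#         ≈⟨ antipode-evaluated nothing F ⟩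
    1# * F nothing + 0#                            ≈⟨ trans (+-identityʳ _) (*-identityˡ _) ⟩
    F nothing                                      ∎

  S-recursion : ∀ w F →
    evalLin (S (just w)) F ≈ - (F (just w) + ∑[ m ∈ properMasks (suc (length w)) ] evalD (map δ w) m (atSProducts F))
  S-recursion w F = solveFor-b (begin
    F (just w) + (evalLin (S (just w)) F + ∑[ m ∈ Ms ] evalD (map δ w) m (atSProducts F))
      ≈⟨ +-cong unitLeft (+-cong unitRight (sym properPart)) ⟩
    1# * atSProduct F nothing (just w) + (1# * atSProduct F (just w) nothing + ∑ (concatMap (D w) Ms) h)
      ≈⟨ antipode-evaluated (just w) F ⟩
    0# * F nothing + 0#                            ≈⟨ trans (+-identityʳ _) (zeroˡ _) ⟩
    0#                                             ∎)
    where
    Ms = properMasks (suc (length w))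
    h : Carrier × Word × Word → Carrier
    h t = proj₁ t * atSProduct F (proj₁ (proj₂ t)) (proj₂ (proj₂ t))
    solveFor-b : ∀ {a b c} → a + (b + c) ≈ 0# → b ≈ - (a + c)
    solveFor-b {a} {b} {c} e = trans (solve 3 (λ a b c → b := (a :+ (b :+ c)) :- (a :+ c)) refl a b c)
                                     (trans (+-congʳ e) (+-identityˡ _))
    unitLeft : F (just w) ≈ 1# * atSProduct F nothing (just w)
    unitLeft = sym (trans (*-identityˡ _) (trans (S-unit (rightMul (just w) F)) (trans (+-identityʳ _) (*-identityˡ _))))
    unitRight : evalLin (S (just w)) F ≈ 1# * atSProduct F (just w) nothing
    unitRight = sym (trans (*-identityˡ _) (evalLin-congʳ (S (just w)) (rightMul-unit F)))
    properPart : ∑ (concatMap (D w) Ms) h ≈ ∑[ m ∈ Ms ] evalD (map δ w) m (atSProducts F)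
    properPart = trans (∑-concatMap (D w) Ms h) (∑-cong Ms (λ m → ∑-D w m (atSProduct F)))

  evalLin-ext : ∀ l F → evalLin (ext S l) F ≈ ∑[ t ∈ l ] (proj₁ t * evalLin (S (proj₂ t)) F)
  evalLin-ext []            F = refl
  evalLin-ext ((k , x) ∷ l) F = trans (evalLin-++ (scale k (S x)) (ext S l) F) (+-cong (evalLin-scale k (S x) F) (evalLin-ext l F))

  evalLin-ext-tensorPow : ∀ τ k F → evalLin (ext S (tensorPow τ (suc k))) F ≈ ⟪ replicate k τ ∣ (λ w → evalLin (S (just w)) F) ⟫
  evalLin-ext-tensorPow τ k F = begin
    evalLin (ext S (tensorPow τ (suc k))) F                             ≈⟨ evalLin-ext (tensorPow τ (suc k)) F ⟩
    ∑[ t ∈ tensorPow τ (suc k) ] (proj₁ t * evalLin (S (proj₂ t)) F)    ≈⟨ reflexive (∑-map (λ w → (prodK (map τ w) , just w)) (allWords k) _) ⟩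
    ∑[ w ∈ allWords k ] (prodK (map τ w) * evalLin (S (just w)) F)      ≈⟨ ∑-allWords-⟪⟫ k τ _ ⟩
    ⟪ replicate k τ ∣ (λ w → evalLin (S (just w)) F) ⟫                  ∎

  S-tensorPow : ∀ τ k F → evalLin (ext S (tensorPow τ (suc k))) F
    ≈ - (⟪ replicate k τ ∣ (λ u → F (just u)) ⟫ + ∑[ m ∈ properMasks (suc k) ] evalD (replicate k τ) m (atSProducts F))
  S-tensorPow τ k F = begin
    evalLin (ext S (tensorPow τ (suc k))) F
      ≈⟨ evalLin-ext-tensorPow τ k F ⟩
    ⟪ τs ∣ (λ w → evalLin (S (just w)) F) ⟫
      ≈⟨ ⟪⟫-cong τs (λ w len → S-recursion′ w (≡.trans len (length-replicate k))) ⟩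
    ⟪ τs ∣ (λ w → - (F (just w) + ∑[ m ∈ Ms ] evalD (map δ w) m (atSProducts F))) ⟫
      ≈⟨ trans (⟪⟫-neg τs _) (-‿cong (⟪⟫-+ τs _ _)) ⟩
    - (⟪ τs ∣ (λ w → F (just w)) ⟫ + ⟪ τs ∣ (λ w → ∑[ m ∈ Ms ] evalD (map δ w) m (atSProducts F)) ⟫)
      ≈⟨ -‿cong (+-congˡ (⟪⟫-∑ τs Ms _)) ⟩
    - (⟪ τs ∣ (λ w → F (just w)) ⟫ + ∑[ m ∈ Ms ] ⟪ τs ∣ (λ w → evalD (map δ w) m (atSProducts F)) ⟫)
      ≈⟨ -‿cong (+-congˡ (∑-properMasks-cong (suc k) (λ m len →
           ⟪⟫-evalD τs m (atSProducts F) (≡.trans len (≡.cong suc (≡.sym (length-replicate k))))))) ⟩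
    - (⟪ τs ∣ (λ u → F (just u)) ⟫ + ∑[ m ∈ Ms ] evalD τs m (atSProducts F)) ∎
    where
    τs = replicate k τ
    Ms = properMasks (suc k)
    S-recursion′ : ∀ w → length w ≡ k →
      evalLin (S (just w)) F ≈ - (F (just w) + ∑[ m ∈ Ms ] evalD (map δ w) m (atSProducts F))
    S-recursion′ w ≡.refl = S-recursion w F

  S-tensorPow-self : ∀ {τ} → ⟨ τ , α ⟩ ≈ 0# → ⟨ τ , β ⟩ ≈ 0# →
    ∀ k F → evalLin (ext S (tensorPow τ (suc k))) F ≈ - evalLin (tensorPow τ (suc k)) F
  S-tensorPow-self {τ} ⟨τ,α⟩≈0 ⟨τ,β⟩≈0 k F = begin
    evalLin (ext S (tensorPow τ (suc k))) F
      ≈⟨ S-tensorPow τ k F ⟩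
    - (⟪ replicate k τ ∣ (λ u → F (just u)) ⟫ + ∑[ m ∈ properMasks (suc k) ] evalD (replicate k τ) m (atSProducts F))
      ≈⟨ -‿cong (trans (+-congˡ (∑-properMasks-evalD≈0 ⟨τ,α⟩≈0 ⟨τ,β⟩≈0 k (atSProducts F))) (+-identityʳ _)) ⟩
    - ⟪ replicate k τ ∣ (λ u → F (just u)) ⟫
      ≈⟨ -‿cong (sym (evalLin-tensorPow τ k F)) ⟩
    - evalLin (tensorPow τ (suc k)) F ∎

  module _ {τ : SCF} (⟨τ,α⟩≈1 : ⟨ τ , α ⟩ ≈ 1#) (⟨τ,β⟩≈0 : ⟨ τ , β ⟩ ≈ 0#) where
    private
      σ : SCF
      σ b = τ b - ι b

      AntipodeOnPower : ℕ → Set (c ⊔ ℓ)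
      AntipodeOnPower p = ∀ F → evalLin (ext S (tensorPow τ (suc p))) F ≈ - evalLin (tensorPow σ (suc p)) F

      insertι : (Word → Carrier) → List Bool → List Bool → Carrier
      insertι F u v = ⟪ ι ∣ (λ b → F (just (u ++ b ∷ v))) ⟫₁

    split-term : ∀ p q F → AntipodeOnPower p →
      ⟪ replicate p τ ∣ (λ u → ⟪ replicate q τ ∣ atSProducts F u ⟫) ⟫ ≈ - ⟪ replicate p σ ∣ (λ u → ⟪ replicate q τ ∣ insertι F u ⟫) ⟫
    split-term p q F S-on-p = begin
      ⟪ replicate p τ ∣ (λ u → ⟪ replicate q τ ∣ atSProducts F u ⟫) ⟫
        ≈⟨ ⟪⟫-swap (replicate p τ) (replicate q τ) (atSProducts F) ⟩
      ⟪ replicate q τ ∣ (λ v → ⟪ replicate p τ ∣ (λ u → atSProducts F u v) ⟫) ⟫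
        ≈⟨ ⟪⟫-cong (replicate q τ) (λ v _ → inner v) ⟩
      ⟪ replicate q τ ∣ (λ v → - ⟪ replicate p σ ∣ (λ u → insertι F u v) ⟫) ⟫
        ≈⟨ ⟪⟫-neg (replicate q τ) _ ⟩
      - ⟪ replicate q τ ∣ (λ v → ⟪ replicate p σ ∣ (λ u → insertι F u v) ⟫) ⟫
        ≈⟨ -‿cong (⟪⟫-swap (replicate q τ) (replicate p σ) (λ v u → insertι F u v)) ⟩
      - ⟪ replicate p σ ∣ (λ u → ⟪ replicate q τ ∣ insertι F u ⟫) ⟫ ∎
      where
      inner : ∀ v → ⟪ replicate p τ ∣ (λ u → atSProducts F u v) ⟫ ≈ - ⟪ replicate p σ ∣ (λ u → insertι F u v) ⟫
      inner v = begin
        ⟪ replicate p τ ∣ (λ u → atSProducts F u v) ⟫           ≈⟨ sym (evalLin-ext-tensorPow τ p (rightMul (just v) F)) ⟩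
        evalLin (ext S (tensorPow τ (suc p))) (rightMul (just v) F)   ≈⟨ S-on-p (rightMul (just v) F) ⟩
        - evalLin (tensorPow σ (suc p)) (rightMul (just v) F)        ≈⟨ -‿cong (evalLin-tensorPow σ p _) ⟩
        - ⟪ replicate p σ ∣ (λ u → rightMul (just v) F (just u)) ⟫   ≈⟨ -‿cong (⟪⟫-cong (replicate p σ) (λ u _ → +-congˡ (+-identityʳ _))) ⟩
        - ⟪ replicate p σ ∣ (λ u → insertι F u v) ⟫                  ∎

    splitPairing-atSProducts : ∀ k → (∀ p → p < k → AntipodeOnPower p) → ∀ F →
      splitPairing ⟨τ,α⟩≈1 ⟨τ,β⟩≈0 k (atSProducts F) ≈ ⟪ replicate k σ ∣ (λ u → F (just u)) ⟫ - ⟪ replicate k τ ∣ (λ u → F (just u)) ⟫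
    splitPairing-atSProducts zero    _  F = sym (-‿inverseʳ _)
    splitPairing-atSProducts (suc k) IH F = begin
      ∑[ p + q ≡ k ] ⟪ replicate p τ ∣ (λ u → ⟪ replicate q τ ∣ atSProducts F u ⟫) ⟫
        ≈⟨ ∑-antidiagonal-cong k (λ p q p+q≡k → split-term p q F (IH p (s≤s (ℕ.m+n≤o⇒m≤o p (ℕ.≤-reflexive p+q≡k))))) ⟩
      ∑[ p + q ≡ k ] (- ⟪ replicate p σ ∣ (λ u → ⟪ replicate q τ ∣ insertι F u ⟫) ⟫)
        ≈⟨ ∑-antidiagonal-neg k _ ⟩
      - ∑[ p + q ≡ k ] ⟪ replicate p σ ∣ (λ u → ⟪ replicate q τ ∣ insertι F u ⟫) ⟫
        ≈⟨ -‿cong (⟪⟫-telescope τ ι k (λ u → F (just u))) ⟩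
      - (⟪ replicate (suc k) τ ∣ (λ u → F (just u)) ⟫ - ⟪ replicate (suc k) σ ∣ (λ u → F (just u)) ⟫)
        ≈⟨ solve 2 (λ x y → :- (x :- y) := y :- x) refl _ _ ⟩
      ⟪ replicate (suc k) σ ∣ (λ u → F (just u)) ⟫ - ⟪ replicate (suc k) τ ∣ (λ u → F (just u)) ⟫ ∎

    S-tensorPow-shifted : ∀ k F → evalLin (ext S (tensorPow τ (suc k))) F ≈ - evalLin (tensorPow σ (suc k)) F
    S-tensorPow-shifted = <-rec AntipodeOnPower (λ k IH → step k (λ p p<k → IH p<k))
      where
      step : ∀ k → (∀ p → p < k → AntipodeOnPower p) → AntipodeOnPower k
      step k IH F = begin
        evalLin (ext S (tensorPow τ (suc k))) F                             ≈⟨ S-tensorPow τ k F ⟩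
        - (⟪ τs ∣ Φ ⟫ + properMaskSum ⟨τ,α⟩≈1 ⟨τ,β⟩≈0 k (atSProducts F))
          ≈⟨ -‿cong (+-congˡ (trans (properMaskSum≈splitPairing ⟨τ,α⟩≈1 ⟨τ,β⟩≈0 k _) (splitPairing-atSProducts k IH F))) ⟩
        - (⟪ τs ∣ Φ ⟫ + (⟪ replicate k σ ∣ Φ ⟫ - ⟪ τs ∣ Φ ⟫))               ≈⟨ solve 2 (λ x y → :- (x :+ (y :- x)) := :- y) refl _ _ ⟩
        - ⟪ replicate k σ ∣ Φ ⟫                                             ≈⟨ -‿cong (sym (evalLin-tensorPow σ k F)) ⟩
        - evalLin (tensorPow σ (suc k)) F                                   ∎
        where
        τs = replicate k τ
        Φ : List Bool → Carrier
        Φ u = F (just u)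

-- Only the antipode equation with S on the left is used: nontriviality of G,
-- the spanning hypothesis and ⟨ι,α⟩ = ⟨ι,β⟩ = 1 (which make H a Hopf algebra,
-- so that S exists) play no role once S is given.
mainTheorem11 : ∀ {c ℓ g ℓg : Level} (K : StarField c ℓ) (G : FiniteGroup g ℓg)
  → let open StarField K
        open Setup K G
    in (∃[ x ] ¬ (FiniteGroup._≈_ G x (FiniteGroup.ε G)))
  → (ι α β : SCF)
  → ⟨ ι , α ⟩ ≈ 1# → ⟨ ι , β ⟩ ≈ 1#
  → let open Hopf ι α β
    in (S : Word → Lin) → IsAntipode S
  → ((∀ x → α x ≈ β x)
       → ∀ (τ : SCF) → ¬ (∀ x → τ x ≈ 0#) → ⟨ τ , β ⟩ ≈ 0#
       → (∀ (f : SCF) → ∃[ a ] ∃[ b ] (∀ x → f x ≈ a * τ x + b * ι x))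
       → ∀ (n : ℕ) → 1 ≤ n → ext S (tensorPow τ n) ≈L negL (tensorPow τ n))
    × (¬ (∀ x → α x ≈ β x)
       → ∀ (τ : SCF) → ⟨ τ , α ⟩ ≈ 1# → ⟨ τ , β ⟩ ≈ 0#
       → ∀ (n : ℕ) → 1 ≤ n
       → ext S (tensorPow τ n) ≈L negL (tensorPow (λ x → τ x - ι x) n))
mainTheorem11 K G _ ι α β _ _ S S-antipode =
    (λ { α≈β τ _ ⟨τ,β⟩≈0 _ (suc k) _ →
           ≈L-negL (ext S (tensorPow τ (suc k))) (tensorPow τ (suc k)) (S-tensorPow-self (trans (⟨⟩-congʳ τ α≈β) ⟨τ,β⟩≈0) ⟨τ,β⟩≈0 k) })
  , (λ { _ τ ⟨τ,α⟩≈1 ⟨τ,β⟩≈0 (suc k) _ → ≈L-negL (ext S (tensorPow τ (suc k))) (tensorPow (λ x → τ x - ι x) (suc k)) (S-tensorPow-shifted ⟨τ,α⟩≈1 ⟨τ,β⟩≈0 k) })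
  where
  open StarField K using (trans; _-_)
  open Setup K G using (tensorPow)
  open Setup.Hopf K G ι α β using (ext)
  open LinearCombinations K G using (≈L-negL; ⟨⟩-congʳ)
  open AntipodeRecursion K G ι α β S S-antipode using (S-tensorPow-self; S-tensorPow-shifted)
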